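{- Let $\mathcal A\in\mathsf{Struc}_{c_1,c_2}$ and $Q=\{c_1,c_2\}^2$. Suppose that $\{c_1\}\in{\rm DEC}_{\mathcal A}$, or that both $\{c_1\}\in{\rm SDEC}_{\mathcal A}$ and $\{c_2\}\in{\rm SDEC}_{\mathcal A}$ hold. Then $\{{\rm Res}_{\mathcal M}\mid\mathcal M\in\mathsf M^{\rm NDB}_{\mathcal A}\}\subseteq\{{\rm Res}_{\mathcal M}\mid\mathcal M\in\mathsf M^\nu_{\mathcal A}(Q)\}$.
   Context: A first-order structure $\mathcal A=(U_{\mathcal A};(c_i)_{i\in N_1};(f_i)_{i\in N_2};(r_i)_{i\in N_3})$ of finite signature consists of a universe, constants, operations and relations; $U_{\mathcal A}^\infty=\bigcup_{n\ge 1}U_{\mathcal A}^n$; $\{c_1\},\{c_2\}$ are sets of 1-tuples. $\mathsf{Struc}_{c_1,c_2}$ is the class of structures having two distinct elements $c_1\ne c_2$ among their constants. A (deterministic) BSS RAM over $\mathcal A$ (class $\mathsf M_{\mathcal A}$) has registers $Z_1,Z_2,\dots$ for elements of $U_{\mathcal A}$, finitely many index registers $I_1,\dots,I_k$ for positive integers, and a finite program of labeled instructions ending with stop; instructions: $Z_j:=f_i(Z_{j_1},\dots,Z_{j_m})$, $Z_j:=c_i$, $Z_j:=Z_k$, $Z_{I_j}:=Z_{I_k}$, $I_j:=1$, $I_j:=I_j+1$, "if $r_i(Z_{j_1},\dots,Z_{j_k})$ then goto $\ell_1$ else goto $\ell_2$", "if $I_j=I_k$ then goto $\ell_1$ else goto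 $\ell_2$", stop, using only the constants, operations and relations of $\mathcal A$ (equality of elements of $U_{\mathcal A}$ can be tested directly only if the identity is a relation of $\mathcal A$); on input $(x_1,\dots,x_n)$ it starts at label 1 with $Z_i=x_i$ ($i\le n$), $Z_i=x_n$ ($i>n$), $I_1=n$, other index registers $1$, and outputs $(Z_1,\dots,Z_{I_1})$ at stop. ${\rm SDEC}_{\mathcal A}$ is the class of halting sets of machines in $\mathsf M_{\mathcal A}$; ${\rm DEC}_{\mathcal A}$ is the class of $P$ with $P$ and $U_{\mathcal A}^\infty\setminus P$ in ${\rm SDEC}_{\mathcal A}$. $\mathsf M^{\rm NDB}_{\mathcal A}$: such machines that may additionally use "$\ell$: goto $\ell_1$ or goto $\ell_2$" (nondeterministic continuation at $\ell_1$ or $\ell_2$). $\mathsf M^\nu_{\mathcal A}(Q)$ for $Q\subseteq U_{\mathcal A}^\infty$: such machines that may additionally use Moschovakis' operator instructions $Z_j:=\nu[\mathcal O](\text{argument registers})$, which nondeterministically assign to $Z_j$ some $y\in U_{\mathcal A}$ with $(\vec z,y)\in Q$, $\vec z$ being the contents of the argument registers (no continuation if no such $y$ exists). For a nondeterministic machine $\mathcal M$, ${\rm Res}_{\mathcal M}:U_{\mathcal A}^\infty\to\mathfrak P(U_{\mathcal A}^\infty)$ maps $\vec x$ to the set of outputs of all computations on $\vec x$ that reach stop. -}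

module Defs where

open import Data.Nat using (ℕ; zero; suc; _≡ᵇ_; _<?_)
open import Data.Bool using (Bool; true; false; if_then_else_)
import Data.Fin as Fin
open import Data.Fin using (Fin; toℕ; fromℕ; fromℕ<) renaming (_≟_ to _≟ᶠ_)
open import Data.Vec as Vec using (Vec; []; _∷_; _∷ʳ_; lookup; tabulate; last)
open import Data.List as List using (List)
open import Data.Product using (Σ; ∃; _×_; _,_)
open import Data.Sum using (_⊎_)
open import Data.Empty using (⊥)
open import Relation.Nullary using (¬_; yes; no)
open import Relation.Binary.PropositionalEquality using (_≡_; _≢_)
open import Relation.Binary.Construct.Closure.ReflexiveTransitive using (Star)
open import Function.Bundles using (_⇔_)

-- First-order structures of finite signature.
-- Relations are given by their characteristic functions (Bool-valued),
-- which (classically) is the same thing as a subset of U^k.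

record Structure : Set₁ where
  field
    U      : Set
    nc     : ℕ
    nf     : ℕ
    nr     : ℕ
    const  : Fin nc → U
    arity  : Fin nf → ℕ
    op     : (i : Fin nf) → Vec U (arity i) → U
    rarity : Fin nr → ℕ
    rel    : (i : Fin nr) → Vec U (rarity i) → Bool

-- U^∞ = ⋃_{n ≥ 1} U^n.  (m , v) represents the (m+1)-tuple v.

Tuple : Set → Set
Tuple U = Σ ℕ (λ m → Vec U (suc m))

Subset∞ : Set → Set₁
Subset∞ U = Tuple U → Set

⟦_⟧₁ : {U : Set} → U → Subset∞ U
⟦ c ⟧₁ x = x ≡ (0 , c ∷ [])

snoc : {U : Set} → List U → U → Tuple U
snoc zs y = (List.length zs , (Vec.fromList zs ∷ʳ y))

-- Conventions (uniform shift by one): the register index j : ℕ denotes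
-- the paper's Z_{j+1}; an index-register content m : ℕ denotes the
-- positive integer m+1; the index registers I_1,…,I_{k+1} are indexed by
-- Fin (suc k) (zero = I_1); labels 1,…,L+1 are Fin (suc L) (zero = label 1),
-- and the last label carries the instruction stop.

data Kind : Set where
  det ndb nu : Kind      -- deterministic / with goto-or / with ν-operator

data Instr (A : Structure) (κ : Kind) (L k : ℕ) : Set where
  opI      : (i : Fin (Structure.nf A)) → (j : ℕ) → Vec ℕ (Structure.arity A i) → Instr A κ L k
  constI   : (j : ℕ) → Fin (Structure.nc A) → Instr A κ L k
  copyI    : (j j' : ℕ) → Instr A κ L k
  indCopyI : (a b : Fin (suc k)) → Instr A κ L k
  setOneI  : (a : Fin (suc k)) → Instr A κ L k
  incI     : (a : Fin (suc k)) → Instr A κ L k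
  relBrI   : (i : Fin (Structure.nr A)) → Vec ℕ (Structure.rarity A i) →
             (ℓ₁ ℓ₂ : Fin (suc L)) → Instr A κ L k
  idxBrI   : (a b : Fin (suc k)) → (ℓ₁ ℓ₂ : Fin (suc L)) → Instr A κ L k
  stopI    : Instr A κ L k
  choiceI  : κ ≡ ndb → (ℓ₁ ℓ₂ : Fin (suc L)) → Instr A κ L k
  nuI      : κ ≡ nu → (j : ℕ) → List ℕ → Instr A κ L k

record Program (A : Structure) (κ : Kind) : Set where
  field
    L     : ℕ
    k     : ℕ
    body  : Fin (suc L) → Instr A κ L k
    ends  : body (fromℕ L) ≡ stopI

module _ (A : Structure) where
  open Structure A

  updZ : (ℕ → U) → ℕ → U → (ℕ → U)
  updZ Z j y m = if j ≡ᵇ m then y else Z m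

  updI : {k : ℕ} → (Fin (suc k) → ℕ) → Fin (suc k) → ℕ → (Fin (suc k) → ℕ)
  updI I a v b with a ≟ᶠ b
  ... | yes _ = v
  ... | no  _ = I b

  record Config (L k : ℕ) : Set where
    constructor ⟨_,_,_⟩
    field
      lab : Fin (suc L)
      reg : ℕ → U
      idx : Fin (suc k) → ℕ

  data Step {κ : Kind} (P : Program A κ) (Q : Subset∞ U) :
       Config (Program.L P) (Program.k P) → Config (Program.L P) (Program.k P) → Set where
    s-op    : ∀ {ℓ ℓ' Z I i j as} → Program.body P ℓ ≡ opI i j as → toℕ ℓ' ≡ suc (toℕ ℓ) →
              Step P Q ⟨ ℓ , Z , I ⟩ ⟨ ℓ' , updZ Z j (op i (Vec.map Z as)) , I ⟩
    s-const : ∀ {ℓ ℓ' Z I j i} → Program.body P ℓ ≡ constI j i → toℕ ℓ' ≡ suc (toℕ ℓ) →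
              Step P Q ⟨ ℓ , Z , I ⟩ ⟨ ℓ' , updZ Z j (const i) , I ⟩
    s-copy  : ∀ {ℓ ℓ' Z I j j'} → Program.body P ℓ ≡ copyI j j' → toℕ ℓ' ≡ suc (toℕ ℓ) →
              Step P Q ⟨ ℓ , Z , I ⟩ ⟨ ℓ' , updZ Z j (Z j') , I ⟩
    s-icopy : ∀ {ℓ ℓ' Z I a b} → Program.body P ℓ ≡ indCopyI a b → toℕ ℓ' ≡ suc (toℕ ℓ) →
              Step P Q ⟨ ℓ , Z , I ⟩ ⟨ ℓ' , updZ Z (I a) (Z (I b)) , I ⟩
    s-one   : ∀ {ℓ ℓ' Z I a} → Program.body P ℓ ≡ setOneI a → toℕ ℓ' ≡ suc (toℕ ℓ) →
              Step P Q ⟨ ℓ , Z , I ⟩ ⟨ ℓ' , Z , updI I a 0 ⟩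
    s-inc   : ∀ {ℓ ℓ' Z I a} → Program.body P ℓ ≡ incI a → toℕ ℓ' ≡ suc (toℕ ℓ) →
              Step P Q ⟨ ℓ , Z , I ⟩ ⟨ ℓ' , Z , updI I a (suc (I a)) ⟩
    s-relT  : ∀ {ℓ Z I i as ℓ₁ ℓ₂} → Program.body P ℓ ≡ relBrI i as ℓ₁ ℓ₂ →
              rel i (Vec.map Z as) ≡ true → Step P Q ⟨ ℓ , Z , I ⟩ ⟨ ℓ₁ , Z , I ⟩
    s-relF  : ∀ {ℓ Z I i as ℓ₁ ℓ₂} → Program.body P ℓ ≡ relBrI i as ℓ₁ ℓ₂ →
              rel i (Vec.map Z as) ≡ false → Step P Q ⟨ ℓ , Z , I ⟩ ⟨ ℓ₂ , Z , I ⟩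
    s-idxT  : ∀ {ℓ Z I a b ℓ₁ ℓ₂} → Program.body P ℓ ≡ idxBrI a b ℓ₁ ℓ₂ →
              I a ≡ I b → Step P Q ⟨ ℓ , Z , I ⟩ ⟨ ℓ₁ , Z , I ⟩
    s-idxF  : ∀ {ℓ Z I a b ℓ₁ ℓ₂} → Program.body P ℓ ≡ idxBrI a b ℓ₁ ℓ₂ →
              I a ≢ I b → Step P Q ⟨ ℓ , Z , I ⟩ ⟨ ℓ₂ , Z , I ⟩
    s-ch₁   : ∀ {ℓ Z I e ℓ₁ ℓ₂} → Program.body P ℓ ≡ choiceI e ℓ₁ ℓ₂ →
              Step P Q ⟨ ℓ , Z , I ⟩ ⟨ ℓ₁ , Z , I ⟩
    s-ch₂   : ∀ {ℓ Z I e ℓ₁ ℓ₂} → Program.body P ℓ ≡ choiceI e ℓ₁ ℓ₂ →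
              Step P Q ⟨ ℓ , Z , I ⟩ ⟨ ℓ₂ , Z , I ⟩
    s-nu    : ∀ {ℓ ℓ' Z I e j as} y → Program.body P ℓ ≡ nuI e j as → toℕ ℓ' ≡ suc (toℕ ℓ) →
              Q (snoc (List.map Z as) y) →
              Step P Q ⟨ ℓ , Z , I ⟩ ⟨ ℓ' , updZ Z j y , I ⟩

  Stopped : {κ : Kind} (P : Program A κ) → Config (Program.L P) (Program.k P) → Set
  Stopped P c = Program.body P (Config.lab c) ≡ stopI

  inputReg : {m : ℕ} → Vec U (suc m) → ℕ → U
  inputReg {m} v j with j <? suc m
  ... | yes p = lookup v (fromℕ< p)
  ... | no  _ = last v

  initial : {κ : Kind} (P : Program A κ) → Tuple U → Config (Program.L P) (Program.k P)
  initial P (m , v) = ⟨ Fin.zero , inputReg v , updI (λ _ → 0) Fin.zero m ⟩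

  output : {L k : ℕ} → Config L k → Tuple U
  output ⟨ _ , Z , I ⟩ = (I Fin.zero , tabulate (λ i → Z (toℕ i)))

  NoOracle : Subset∞ U
  NoOracle _ = ⊥

  ResQ : {κ : Kind} → Subset∞ U → (P : Program A κ) → Tuple U → Tuple U → Set
  ResQ Q P x y = ∃ λ c → Star (Step P Q) (initial P x) c × Stopped P c × output c ≡ y

  Halts : Program A det → Tuple U → Set
  Halts P x = ∃ λ c → Star (Step P NoOracle) (initial P x) c × Stopped P c

  SDEC : Subset∞ U → Set
  SDEC S = Σ (Program A det) λ P → ∀ x → (S x ⇔ Halts P x)

  DEC : Subset∞ U → Set
  DEC S = SDEC S × SDEC (λ x → ¬ S x)

  ResNDB : Program A ndb → Tuple U → Tuple U → Set
  ResNDB = ResQ NoOracle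

  Resν : Subset∞ U → Program A nu → Tuple U → Tuple U → Set
  Resν Q = ResQ Q

  Pairs : U → U → Subset∞ U
  Pairs a b t = Σ U λ u → Σ U λ w → (u ≡ a ⊎ u ≡ b) × (w ≡ a ⊎ w ≡ b) × t ≡ (1 , u ∷ w ∷ [])

{-# OPTIONS --safe #-}
module Submission where

-- Both hypotheses provide a deterministic machine P halting exactly on c₁. A branch
-- "goto ℓ₁ or goto ℓ₂" of M is simulated by guessing y ∈ {c₁, c₂} with ν and then
-- telling c₁ from c₂ with P. Running P on y would lose the branch y = c₂, where P
-- diverges; instead the halting computation of P on c₁ is recorded once and for all as
-- straight-line code (index arithmetic evaluated, each relation test with its outcome).
-- Replaying it on y reaches its end for y = c₁; for y = c₂ some test must fail, since
-- otherwise P would halt on c₂. The replay overwrites the registers [0, K) of M, which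
-- are therefore saved above a frontier beyond which all registers of M hold one common
-- value, and restored afterwards. The simulation runs block by block in both directions:
-- every step of M is matched by a run of its block, and every halting run of the
-- simulating machine decomposes into such block runs.

open import Defs
open import Data.Nat using (ℕ; zero; suc; _+_; _*_; _∸_; _≤_; _<_; z≤n; s≤s; _≡ᵇ_; _<?_; NonZero; _/_; _%_; >-nonZero)
open import Data.Nat.Properties
open import Data.Nat.DivMod
open import Data.Nat.Divisibility using (divides-refl)
open import Data.Bool using (Bool; true; false; T)
open import Data.Unit using (tt)
import Data.Fin as Fin
open import Data.Fin using (Fin; toℕ; fromℕ; fromℕ<; _↑ˡ_; _↑ʳ_) renaming (_≟_ to _≟ᶠ_)
import Data.Fin.Properties as FinP
open import Data.Vec as Vec using (Vec; []; _∷_)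
import Data.Vec.Properties as VecP
open import Data.List as List using (List; []; _∷_; _++_; length)
import Data.List.Properties as ListP
open import Data.List.Relation.Unary.All as All using (All; []; _∷_)
open import Data.List.Membership.Propositional.Properties using (∈-tabulate⁺)
open import Data.List.Extrema.Nat using (max; xs≤max)
open import Data.List.Relation.Unary.All.Properties using (++⁺; ++⁻)
open import Data.Product using (Σ; ∃; _×_; _,_; proj₁; proj₂)
open import Data.Sum using (_⊎_; inj₁; inj₂; [_,_]′)
open import Data.Empty using (⊥; ⊥-elim)
open import Relation.Nullary using (¬_; yes; no; Dec)
open import Relation.Binary.PropositionalEquality
open import Relation.Binary.Construct.Closure.ReflexiveTransitive using (Star; ε; _◅_; _◅◅_)
open import Function.Bundles using (_⇔_; mk⇔; Equivalence)

data Steps {C : Set} (R : C → C → Set) : ℕ → C → C → Set where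
  done : ∀ {c} → Steps R 0 c c
  _∷ₛ_ : ∀ {n c d e} → R c d → Steps R n d e → Steps R (suc n) c e

Star⇒Steps : ∀ {C : Set} {R : C → C → Set} {c d} → Star R c d → ∃ λ n → Steps R n c d
Star⇒Steps ε = 0 , done
Star⇒Steps (s ◅ ss) with Star⇒Steps ss
... | n , t = suc n , (s ∷ₛ t)

≡ᵇ-refl : ∀ n → (n ≡ᵇ n) ≡ true
≡ᵇ-refl zero = refl
≡ᵇ-refl (suc n) = ≡ᵇ-refl n

≢⇒≡ᵇ-false : ∀ m n → m ≢ n → (m ≡ᵇ n) ≡ false
≢⇒≡ᵇ-false m n m≢n with m ≡ᵇ n in eq
... | true = ⊥-elim (m≢n (≡ᵇ⇒≡ m n (subst T (sym eq) tt)))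
... | false = refl

module MachineFacts (A : Structure) where
  open Structure A

  updZ-same : ∀ (Z : ℕ → U) j y → updZ A Z j y j ≡ y
  updZ-same Z j y rewrite ≡ᵇ-refl j = refl

  updZ-other : ∀ (Z : ℕ → U) j y m → j ≢ m → updZ A Z j y m ≡ Z m
  updZ-other Z j y m j≢m rewrite ≢⇒≡ᵇ-false j m j≢m = refl

  updZ-cong : ∀ {Z Z′ : ℕ → U} j {y y′} → (∀ m → Z m ≡ Z′ m) → y ≡ y′ → ∀ m → updZ A Z j y m ≡ updZ A Z′ j y′ m
  updZ-cong j Z≗Z′ y≡y′ m with j ≡ᵇ m
  ... | true = y≡y′
  ... | false = Z≗Z′ m

  updI-same : ∀ {k} (I : Fin (suc k) → ℕ) a v → updI A I a v a ≡ v
  updI-same I a v with a ≟ᶠ a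
  ... | yes _ = refl
  ... | no a≢a = ⊥-elim (a≢a refl)

  updI-other : ∀ {k} (I : Fin (suc k) → ℕ) a v b → a ≢ b → updI A I a v b ≡ I b
  updI-other I a v b a≢b with a ≟ᶠ b
  ... | yes a≡b = ⊥-elim (a≢b a≡b)
  ... | no _ = refl

  inputReg-singleton : ∀ (y : U) j → inputReg A (y ∷ []) j ≡ y
  inputReg-singleton y zero = refl
  inputReg-singleton y (suc j) = refl

  inputReg-beyond : ∀ {m} (v : Vec U (suc m)) j → m < j → inputReg A v j ≡ Vec.last v
  inputReg-beyond {m} v j m<j with j <? suc m
  ... | yes j<1+m = ⊥-elim (<-irrefl refl (<-≤-trans m<j (≤-pred j<1+m)))
  ... | no _ = refl

  module _ {κ : Kind} (P : Program A κ) where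
    open Program P

    successor-label : ∀ ℓ → body ℓ ≢ stopI → Σ (Fin (suc L)) λ ℓ′ → toℕ ℓ′ ≡ suc (toℕ ℓ)
    successor-label ℓ not-stop with m≤n⇒m<n∨m≡n (≤-pred (FinP.toℕ<n ℓ))
    ... | inj₁ ℓ<L = fromℕ< (s≤s ℓ<L) , FinP.toℕ-fromℕ< (s≤s ℓ<L)
    ... | inj₂ ℓ≡L = ⊥-elim (not-stop (subst (λ ℓ′ → body ℓ′ ≡ stopI) (sym (FinP.toℕ-injective (trans ℓ≡L (sym (FinP.toℕ-fromℕ L))))) ends))

  module _ {κ : Kind} (P : Program A κ) (Q : Subset∞ U) where
    open Program P

    Successor : Instr A κ L k → Fin (suc L) → (ℕ → U) → (Fin (suc k) → ℕ) → Config A L k → Set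
    Successor (opI i j as) ℓ Z I d = Σ (Fin (suc L)) λ ℓ′ → toℕ ℓ′ ≡ suc (toℕ ℓ) × d ≡ ⟨ ℓ′ , updZ A Z j (op i (Vec.map Z as)) , I ⟩
    Successor (constI j c) ℓ Z I d = Σ (Fin (suc L)) λ ℓ′ → toℕ ℓ′ ≡ suc (toℕ ℓ) × d ≡ ⟨ ℓ′ , updZ A Z j (const c) , I ⟩
    Successor (copyI j j′) ℓ Z I d = Σ (Fin (suc L)) λ ℓ′ → toℕ ℓ′ ≡ suc (toℕ ℓ) × d ≡ ⟨ ℓ′ , updZ A Z j (Z j′) , I ⟩
    Successor (indCopyI a b) ℓ Z I d = Σ (Fin (suc L)) λ ℓ′ → toℕ ℓ′ ≡ suc (toℕ ℓ) × d ≡ ⟨ ℓ′ , updZ A Z (I a) (Z (I b)) , I ⟩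
    Successor (setOneI a) ℓ Z I d = Σ (Fin (suc L)) λ ℓ′ → toℕ ℓ′ ≡ suc (toℕ ℓ) × d ≡ ⟨ ℓ′ , Z , updI A I a 0 ⟩
    Successor (incI a) ℓ Z I d = Σ (Fin (suc L)) λ ℓ′ → toℕ ℓ′ ≡ suc (toℕ ℓ) × d ≡ ⟨ ℓ′ , Z , updI A I a (suc (I a)) ⟩
    Successor (relBrI i as ℓ₁ ℓ₂) ℓ Z I d =
      (rel i (Vec.map Z as) ≡ true × d ≡ ⟨ ℓ₁ , Z , I ⟩) ⊎ (rel i (Vec.map Z as) ≡ false × d ≡ ⟨ ℓ₂ , Z , I ⟩)
    Successor (idxBrI a b ℓ₁ ℓ₂) ℓ Z I d = (I a ≡ I b × d ≡ ⟨ ℓ₁ , Z , I ⟩) ⊎ (I a ≢ I b × d ≡ ⟨ ℓ₂ , Z , I ⟩)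
    Successor stopI ℓ Z I d = ⊥
    Successor (choiceI _ ℓ₁ ℓ₂) ℓ Z I d = d ≡ ⟨ ℓ₁ , Z , I ⟩ ⊎ d ≡ ⟨ ℓ₂ , Z , I ⟩
    Successor (nuI _ j as) ℓ Z I d =
      Σ U λ y → Σ (Fin (suc L)) λ ℓ′ → toℕ ℓ′ ≡ suc (toℕ ℓ) × Q (snoc (List.map Z as) y) × d ≡ ⟨ ℓ′ , updZ A Z j y , I ⟩

    step-successor : ∀ {ℓ Z I d} → Step A P Q ⟨ ℓ , Z , I ⟩ d → Successor (body ℓ) ℓ Z I d
    step-successor (s-op eq p) rewrite eq = _ , p , refl
    step-successor (s-const eq p) rewrite eq = _ , p , refl
    step-successor (s-copy eq p) rewrite eq = _ , p , refl
    step-successor (s-icopy eq p) rewrite eq = _ , p , refl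
    step-successor (s-one eq p) rewrite eq = _ , p , refl
    step-successor (s-inc eq p) rewrite eq = _ , p , refl
    step-successor (s-relT eq r) rewrite eq = inj₁ (r , refl)
    step-successor (s-relF eq r) rewrite eq = inj₂ (r , refl)
    step-successor (s-idxT eq r) rewrite eq = inj₁ (r , refl)
    step-successor (s-idxF eq r) rewrite eq = inj₂ (r , refl)
    step-successor (s-ch₁ eq) rewrite eq = inj₁ refl
    step-successor (s-ch₂ eq) rewrite eq = inj₂ refl
    step-successor (s-nu y eq p q) rewrite eq = y , _ , p , q , refl

    stopped-irreducible : ∀ {c d} → Stopped A P c → Step A P Q c d → ⊥
    stopped-irreducible {⟨ ℓ , Z , I ⟩} stop s with step-successor s
    ... | succ rewrite stop = succ

data AsmInstr (A : Structure) (k : ℕ) : Set where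
  pOp    : (i : Fin (Structure.nf A)) → ℕ → Vec ℕ (Structure.arity A i) → AsmInstr A k
  pConst : ℕ → Fin (Structure.nc A) → AsmInstr A k
  pCopy  : ℕ → ℕ → AsmInstr A k
  pICopy : Fin (suc k) → Fin (suc k) → AsmInstr A k
  pOne   : Fin (suc k) → AsmInstr A k
  pInc   : Fin (suc k) → AsmInstr A k
  pRel   : (i : Fin (Structure.nr A)) → Vec ℕ (Structure.rarity A i) → ℕ → ℕ → AsmInstr A k
  pIdx   : Fin (suc k) → Fin (suc k) → ℕ → ℕ → AsmInstr A k
  pStop  : AsmInstr A k
  pNu    : ℕ → List ℕ → AsmInstr A k

data Straight {A : Structure} {k : ℕ} : AsmInstr A k → Set where
  opS    : ∀ {i j as} → Straight (pOp i j as)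
  constS : ∀ {j c} → Straight (pConst j c)
  copyS  : ∀ {j j′} → Straight (pCopy j j′)
  icopyS : ∀ {a b} → Straight (pICopy a b)
  oneS   : ∀ {a} → Straight (pOne a)
  incS   : ∀ {a} → Straight (pInc a)

-- The machines have no unconditional jump; the test I_a = I_a serves as one.
goto : ∀ {A k} → Fin (suc k) → ℕ → AsmInstr A k
goto a t = pIdx a a t t

module StraightLine (A : Structure) (k : ℕ) where
  open Structure A

  execZ : AsmInstr A k → (ℕ → U) → (Fin (suc k) → ℕ) → (ℕ → U)
  execZ (pOp i j as) Z I = updZ A Z j (op i (Vec.map Z as))
  execZ (pConst j c) Z I = updZ A Z j (const c)
  execZ (pCopy j j′) Z I = updZ A Z j (Z j′)
  execZ (pICopy a b) Z I = updZ A Z (I a) (Z (I b))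
  execZ _ Z I = Z

  execI : AsmInstr A k → (ℕ → U) → (Fin (suc k) → ℕ) → (Fin (suc k) → ℕ)
  execI (pOne a) Z I = updI A I a 0
  execI (pInc a) Z I = updI A I a (suc (I a))
  execI _ Z I = I

  runZ : List (AsmInstr A k) → (ℕ → U) → (Fin (suc k) → ℕ) → (ℕ → U)
  runI : List (AsmInstr A k) → (ℕ → U) → (Fin (suc k) → ℕ) → (Fin (suc k) → ℕ)
  runZ [] Z I = Z
  runZ (x ∷ xs) Z I = runZ xs (execZ x Z I) (execI x Z I)
  runI [] Z I = I
  runI (x ∷ xs) Z I = runI xs (execZ x Z I) (execI x Z I)

  runZ-++ : ∀ xs ys Z I → runZ (xs ++ ys) Z I ≡ runZ ys (runZ xs Z I) (runI xs Z I)
  runZ-++ [] ys Z I = refl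
  runZ-++ (x ∷ xs) ys Z I = runZ-++ xs ys (execZ x Z I) (execI x Z I)

  runI-++ : ∀ xs ys Z I → runI (xs ++ ys) Z I ≡ runI ys (runZ xs Z I) (runI xs Z I)
  runI-++ [] ys Z I = refl
  runI-++ (x ∷ xs) ys Z I = runI-++ xs ys (execZ x Z I) (execI x Z I)

clamp : (N : ℕ) → ℕ → Fin (suc N)
clamp N zero = Fin.zero
clamp zero (suc n) = Fin.zero
clamp (suc N) (suc n) = Fin.suc (clamp N n)

toℕ-clamp : ∀ N p → p ≤ N → toℕ (clamp N p) ≡ p
toℕ-clamp N zero _ = refl
toℕ-clamp (suc N) (suc p) (s≤s p≤N) = cong suc (toℕ-clamp N p p≤N)

-- Jump targets are numeric addresses; those beyond N are clamped to the final stop.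
module Assembly (A : Structure) (k N : ℕ) (code : ℕ → AsmInstr A k) where
  open Structure A
  open MachineFacts A
  open StraightLine A k

  opaque
    label : ℕ → Fin (suc N)
    label = clamp N

  opaque
    unfolding label
    toℕ-label : ∀ p → p ≤ N → toℕ (label p) ≡ p
    toℕ-label = toℕ-clamp N
    label-zero : label 0 ≡ Fin.zero
    label-zero = refl

  assemble : AsmInstr A k → Instr A nu N k
  assemble (pOp i j as) = opI i j as
  assemble (pConst j c) = constI j c
  assemble (pCopy j j′) = copyI j j′
  assemble (pICopy a b) = indCopyI a b
  assemble (pOne a) = setOneI a
  assemble (pInc a) = incI a
  assemble (pRel i as t₁ t₂) = relBrI i as (label t₁) (label t₂)
  assemble (pIdx a b t₁ t₂) = idxBrI a b (label t₁) (label t₂)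
  assemble pStop = stopI
  assemble (pNu j as) = nuI refl j as

  bodyAt : ℕ → Instr A nu N k
  bodyAt p with p <? N
  ... | yes _ = assemble (code p)
  ... | no _ = stopI

  bodyAt-< : ∀ p → p < N → bodyAt p ≡ assemble (code p)
  bodyAt-< p p<N with p <? N
  ... | yes _ = refl
  ... | no p≮N = ⊥-elim (p≮N p<N)

  bodyAt-≥ : ∀ p → N ≤ p → bodyAt p ≡ stopI
  bodyAt-≥ p N≤p with p <? N
  ... | yes p<N = ⊥-elim (<-irrefl refl (<-≤-trans p<N N≤p))
  ... | no _ = refl

  program : Program A nu
  program = record
    { L = N ; k = k ; body = λ ℓ → bodyAt (toℕ ℓ)
    ; ends = bodyAt-≥ (toℕ (fromℕ N)) (≤-reflexive (sym (FinP.toℕ-fromℕ N))) }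

  Cfg : Set
  Cfg = Config A N k

  data CodeAt : ℕ → List (AsmInstr A k) → ℕ → Set where
    []  : ∀ {s} → s ≤ N → CodeAt s [] s
    _∷_ : ∀ {s x xs e} → code s ≡ x → CodeAt (suc s) xs e → CodeAt s (x ∷ xs) e

  CodeAt-≤ : ∀ {s xs e} → CodeAt s xs e → s ≤ N
  CodeAt-≤ ([] s≤N) = s≤N
  CodeAt-≤ (_ ∷ at) = ≤-trans (n≤1+n _) (CodeAt-≤ at)

  CodeAt-< : ∀ {s x xs e} → CodeAt s (x ∷ xs) e → s < N
  CodeAt-< (_ ∷ at) = CodeAt-≤ at

  CodeAt-head : ∀ {s x xs e} → CodeAt s (x ∷ xs) e → code s ≡ x
  CodeAt-head (c ∷ _) = c

  CodeAt-tail : ∀ {s x xs e} → CodeAt s (x ∷ xs) e → CodeAt (suc s) xs e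
  CodeAt-tail (_ ∷ at) = at

  CodeAt-++ : ∀ {s e} xs {ys} → CodeAt s (xs ++ ys) e → CodeAt s xs (length xs + s) × CodeAt (length xs + s) ys e
  CodeAt-++ [] at = [] (CodeAt-≤ at) , at
  CodeAt-++ {s} {e} (x ∷ xs) {ys} (c ∷ at) =
    (c ∷ subst (CodeAt (suc s) xs) (+-suc (length xs) s) (proj₁ (CodeAt-++ xs at))) ,
    subst (λ z → CodeAt z ys e) (+-suc (length xs) s) (proj₂ (CodeAt-++ xs at))

  body-label : ∀ {p x} → p < N → code p ≡ x → Program.body program (label p) ≡ assemble x
  body-label {p} p<N c rewrite toℕ-label p (<⇒≤ p<N) = trans (bodyAt-< p p<N) (cong assemble c)

  toℕ-label-suc : ∀ p → suc p ≤ N → toℕ (label (suc p)) ≡ suc (toℕ (label p))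
  toℕ-label-suc p p<N rewrite toℕ-label (suc p) p<N | toℕ-label p (<⇒≤ p<N) = refl

  next-label : ∀ p (ℓ : Fin (suc N)) → suc p ≤ N → toℕ ℓ ≡ suc (toℕ (label p)) → ℓ ≡ label (suc p)
  next-label p ℓ p<N e = FinP.toℕ-injective (trans e (sym (toℕ-label-suc p p<N)))

  module _ (Q : Subset∞ U) where
    Move : Cfg → Cfg → Set
    Move = Step A program Q

    Halted : Cfg → Set
    Halted = Stopped A program

    successor-at : ∀ {p x Z I d} → p < N → code p ≡ x → Move ⟨ label p , Z , I ⟩ d →
                   Successor program Q (assemble x) (label p) Z I d
    successor-at {p} {x} {Z} {I} {d} p<N c s =
      subst (λ X → Successor program Q X (label p) Z I d) (body-label p<N c) (step-successor program Q s)

    straight-step : ∀ {p x} Z I → p < N → code p ≡ x → Straight x →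
                    Move ⟨ label p , Z , I ⟩ ⟨ label (suc p) , execZ x Z I , execI x Z I ⟩
    straight-step {p} Z I p<N c opS = s-op (body-label p<N c) (toℕ-label-suc p p<N)
    straight-step {p} Z I p<N c constS = s-const (body-label p<N c) (toℕ-label-suc p p<N)
    straight-step {p} Z I p<N c copyS = s-copy (body-label p<N c) (toℕ-label-suc p p<N)
    straight-step {p} Z I p<N c icopyS = s-icopy (body-label p<N c) (toℕ-label-suc p p<N)
    straight-step {p} Z I p<N c oneS = s-one (body-label p<N c) (toℕ-label-suc p p<N)
    straight-step {p} Z I p<N c incS = s-inc (body-label p<N c) (toℕ-label-suc p p<N)

    straight-step⁻¹ : ∀ {p x Z I d} → p < N → code p ≡ x → Straight x → Move ⟨ label p , Z , I ⟩ d →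
                      d ≡ ⟨ label (suc p) , execZ x Z I , execI x Z I ⟩
    straight-step⁻¹ {p} p<N c opS s with successor-at p<N c s
    ... | ℓ , e , refl rewrite next-label p ℓ p<N e = refl
    straight-step⁻¹ {p} p<N c constS s with successor-at p<N c s
    ... | ℓ , e , refl rewrite next-label p ℓ p<N e = refl
    straight-step⁻¹ {p} p<N c copyS s with successor-at p<N c s
    ... | ℓ , e , refl rewrite next-label p ℓ p<N e = refl
    straight-step⁻¹ {p} p<N c icopyS s with successor-at p<N c s
    ... | ℓ , e , refl rewrite next-label p ℓ p<N e = refl
    straight-step⁻¹ {p} p<N c oneS s with successor-at p<N c s
    ... | ℓ , e , refl rewrite next-label p ℓ p<N e = refl
    straight-step⁻¹ {p} p<N c incS s with successor-at p<N c s
    ... | ℓ , e , refl rewrite next-label p ℓ p<N e = refl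

    straight-not-halted : ∀ {p x Z I} → p < N → code p ≡ x → Straight x → ¬ Halted ⟨ label p , Z , I ⟩
    straight-not-halted p<N c sx stop with trans (sym (body-label p<N c)) stop
    straight-not-halted p<N c opS stop | ()
    straight-not-halted p<N c constS stop | ()
    straight-not-halted p<N c copyS stop | ()
    straight-not-halted p<N c icopyS stop | ()
    straight-not-halted p<N c oneS stop | ()
    straight-not-halted p<N c incS stop | ()

    run-straight : ∀ {s xs e} Z I → CodeAt s xs e → All Straight xs →
                   Star Move ⟨ label s , Z , I ⟩ ⟨ label e , runZ xs Z I , runI xs Z I ⟩
    run-straight Z I ([] _) [] = ε
    run-straight Z I (c ∷ at) (sx ∷ sxs) = straight-step Z I (CodeAt-≤ at) c sx ◅ run-straight _ _ at sxs

    run-straight⁻¹ : ∀ {s xs e n f} Z I → CodeAt s xs e → All Straight xs → Steps Move n ⟨ label s , Z , I ⟩ f → Halted f →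
                     Σ ℕ λ m → m ≤ n × Steps Move m ⟨ label e , runZ xs Z I , runI xs Z I ⟩ f
    run-straight⁻¹ Z I ([] _) [] ss stop = _ , ≤-refl , ss
    run-straight⁻¹ Z I (c ∷ at) (sx ∷ sxs) done stop = ⊥-elim (straight-not-halted {Z = Z} {I = I} (CodeAt-≤ at) c sx stop)
    run-straight⁻¹ Z I (c ∷ at) (sx ∷ sxs) (s ∷ₛ ss) stop with straight-step⁻¹ (CodeAt-≤ at) c sx s
    ... | refl with run-straight⁻¹ _ _ at sxs ss stop
    ... | m , m≤n , rest = m , m≤n⇒m≤1+n m≤n , rest

    rel-true-step : ∀ {p i as t₁ t₂} Z I → p < N → code p ≡ pRel i as t₁ t₂ → rel i (Vec.map Z as) ≡ true →
                    Move ⟨ label p , Z , I ⟩ ⟨ label t₁ , Z , I ⟩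
    rel-true-step Z I p<N c r = s-relT (body-label p<N c) r

    rel-false-step : ∀ {p i as t₁ t₂} Z I → p < N → code p ≡ pRel i as t₁ t₂ → rel i (Vec.map Z as) ≡ false →
                     Move ⟨ label p , Z , I ⟩ ⟨ label t₂ , Z , I ⟩
    rel-false-step Z I p<N c r = s-relF (body-label p<N c) r

    idx-true-step : ∀ {p a b t₁ t₂} Z I → p < N → code p ≡ pIdx a b t₁ t₂ → I a ≡ I b →
                    Move ⟨ label p , Z , I ⟩ ⟨ label t₁ , Z , I ⟩
    idx-true-step Z I p<N c e = s-idxT (body-label p<N c) e

    idx-false-step : ∀ {p a b t₁ t₂} Z I → p < N → code p ≡ pIdx a b t₁ t₂ → I a ≢ I b →
                     Move ⟨ label p , Z , I ⟩ ⟨ label t₂ , Z , I ⟩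
    idx-false-step Z I p<N c e = s-idxF (body-label p<N c) e

    goto-step : ∀ {p a t} Z I → p < N → code p ≡ goto a t → Move ⟨ label p , Z , I ⟩ ⟨ label t , Z , I ⟩
    goto-step Z I p<N c = s-idxT (body-label p<N c) refl

    nu-step : ∀ {p j as} Z I y → p < N → code p ≡ pNu j as → Q (snoc (List.map Z as) y) →
              Move ⟨ label p , Z , I ⟩ ⟨ label (suc p) , updZ A Z j y , I ⟩
    nu-step {p} Z I y p<N c q = s-nu y (body-label p<N c) (toℕ-label-suc p p<N) q

    stop-halted : ∀ {p Z I} → p < N → code p ≡ pStop → Halted ⟨ label p , Z , I ⟩
    stop-halted p<N c = body-label p<N c

    halted-irreducible : ∀ {c d} → Halted c → ¬ Move c d
    halted-irreducible = stopped-irreducible program Q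

    rel-steps⁻¹ : ∀ {p i as t₁ t₂ Z I n f} → p < N → code p ≡ pRel i as t₁ t₂ → Steps Move n ⟨ label p , Z , I ⟩ f → Halted f →
                  Σ ℕ λ m → m < n × ((rel i (Vec.map Z as) ≡ true × Steps Move m ⟨ label t₁ , Z , I ⟩ f)
                                    ⊎ (rel i (Vec.map Z as) ≡ false × Steps Move m ⟨ label t₂ , Z , I ⟩ f))
    rel-steps⁻¹ p<N c done stop with trans (sym (body-label p<N c)) stop
    ... | ()
    rel-steps⁻¹ p<N c (s ∷ₛ ss) stop with successor-at p<N c s
    ... | inj₁ (r , refl) = _ , ≤-refl , inj₁ (r , ss)
    ... | inj₂ (r , refl) = _ , ≤-refl , inj₂ (r , ss)

    idx-steps⁻¹ : ∀ {p a b t₁ t₂ Z I n f} → p < N → code p ≡ pIdx a b t₁ t₂ → Steps Move n ⟨ label p , Z , I ⟩ f → Halted f →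
                  Σ ℕ λ m → m < n × ((I a ≡ I b × Steps Move m ⟨ label t₁ , Z , I ⟩ f) ⊎ (I a ≢ I b × Steps Move m ⟨ label t₂ , Z , I ⟩ f))
    idx-steps⁻¹ p<N c done stop with trans (sym (body-label p<N c)) stop
    ... | ()
    idx-steps⁻¹ p<N c (s ∷ₛ ss) stop with successor-at p<N c s
    ... | inj₁ (e , refl) = _ , ≤-refl , inj₁ (e , ss)
    ... | inj₂ (e , refl) = _ , ≤-refl , inj₂ (e , ss)

    goto-steps⁻¹ : ∀ {p a t Z I n f} → p < N → code p ≡ goto a t → Steps Move n ⟨ label p , Z , I ⟩ f → Halted f →
                   Σ ℕ λ m → m < n × Steps Move m ⟨ label t , Z , I ⟩ f
    goto-steps⁻¹ p<N c ss stop with idx-steps⁻¹ p<N c ss stop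
    ... | m , m<n , inj₁ (_ , rest) = m , m<n , rest
    ... | m , m<n , inj₂ (_ , rest) = m , m<n , rest

    straight-steps⁻¹ : ∀ {p x Z I n f} → p < N → code p ≡ x → Straight x → Steps Move n ⟨ label p , Z , I ⟩ f → Halted f →
                       Σ ℕ λ m → m < n × Steps Move m ⟨ label (suc p) , execZ x Z I , execI x Z I ⟩ f
    straight-steps⁻¹ {Z = Z} {I} p<N c sx done stop = ⊥-elim (straight-not-halted {Z = Z} {I = I} p<N c sx stop)
    straight-steps⁻¹ {f = f} p<N c sx (s ∷ₛ ss) stop = _ , ≤-refl , subst (λ d → Steps Move _ d f) (straight-step⁻¹ p<N c sx s) ss

    nu-steps⁻¹ : ∀ {p j as Z I n f} → p < N → code p ≡ pNu j as → Steps Move n ⟨ label p , Z , I ⟩ f → Halted f →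
                 Σ U λ y → Q (snoc (List.map Z as) y) × Σ ℕ λ m → m < n × Steps Move m ⟨ label (suc p) , updZ A Z j y , I ⟩ f
    nu-steps⁻¹ p<N c done stop with trans (sym (body-label p<N c)) stop
    ... | ()
    nu-steps⁻¹ {p} {f = f} p<N c (s ∷ₛ ss) stop with successor-at p<N c s
    ... | y , ℓ , e , q , refl rewrite next-label p ℓ p<N e = y , q , _ , ≤-refl , ss

    run-straight-goto : ∀ {p t e} a xs Z I → CodeAt p (xs ++ (goto a t ∷ [])) e → All Straight xs →
                        Star Move ⟨ label p , Z , I ⟩ ⟨ label t , runZ xs Z I , runI xs Z I ⟩
    run-straight-goto a xs Z I at sxs =
      run-straight Z I (proj₁ split) sxs ◅◅ (goto-step _ _ (CodeAt-< (proj₂ split)) (CodeAt-head (proj₂ split)) ◅ ε)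
      where
        split = CodeAt-++ xs at

    run-straight-goto⁻¹ : ∀ {p t e n f} a xs Z I → CodeAt p (xs ++ (goto a t ∷ [])) e → All Straight xs →
                          Steps Move n ⟨ label p , Z , I ⟩ f → Halted f →
                          Σ ℕ λ m → m < n × Steps Move m ⟨ label t , runZ xs Z I , runI xs Z I ⟩ f
    run-straight-goto⁻¹ a xs Z I at sxs ss stop with CodeAt-++ xs at
    ... | at-xs , at-goto with run-straight⁻¹ Z I at-xs sxs ss stop
    ... | m , m≤n , rest with goto-steps⁻¹ (CodeAt-< at-goto) (CodeAt-head at-goto) rest stop
    ... | m′ , m′<m , rest′ = m′ , <-≤-trans m′<m m≤n , rest′

[m*n+o]/n≡m : ∀ m {n o} .{{_ : NonZero n}} → o < n → (m * n + o) / n ≡ m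
[m*n+o]/n≡m m {n} {o} o<n = begin
  (m * n + o) / n    ≡⟨ +-distrib-/-∣ˡ o (divides-refl m) ⟩
  m * n / n + o / n  ≡⟨ cong₂ _+_ (m*n/n≡m m n) (m<n⇒m/n≡0 o<n) ⟩
  m + 0              ≡⟨ +-identityʳ m ⟩
  m                  ∎
  where open ≡-Reasoning

[m*n+o]%n≡o : ∀ m {n o} .{{_ : NonZero n}} → o < n → (m * n + o) % n ≡ o
[m*n+o]%n≡o m {n} {o} o<n = begin
  (m * n + o) % n  ≡⟨ cong (_% n) (+-comm (m * n) o) ⟩
  (o + m * n) % n  ≡⟨ [m+kn]%n≡m%n o m n ⟩
  o % n            ≡⟨ m<n⇒m%n≡m o<n ⟩
  o                ∎
  where open ≡-Reasoning

lookupOr : ∀ {X : Set} → X → List X → ℕ → X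
lookupOr x₀ [] _ = x₀
lookupOr x₀ (x ∷ xs) zero = x
lookupOr x₀ (x ∷ xs) (suc n) = lookupOr x₀ xs n

-- Code layout: the prologue at addresses [0, base), then one block of B
-- addresses for each label ℓ, starting at base + ℓ * B.
module Layout (A : Structure) (k L base B : ℕ) {{_ : NonZero B}}
              (prologue : List (AsmInstr A k)) (block : Fin (suc L) → List (AsmInstr A k)) where

  opaque
    N : ℕ
    N = base + suc L * B

  blockStart : ℕ → ℕ
  blockStart n = base + n * B

  blockInstr : ℕ → ℕ → AsmInstr A k
  blockInstr n t with n <? suc L
  ... | yes n<1+L = lookupOr pStop (block (fromℕ< n<1+L)) t
  ... | no _ = pStop

  opaque
    code : ℕ → AsmInstr A k
    code p with p <? base
    ... | yes _ = lookupOr pStop prologue p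
    ... | no _ = blockInstr ((p ∸ base) / B) ((p ∸ base) % B)

  open Assembly A k N code public

  CodeAt-lookup : ∀ (xs : List (AsmInstr A k)) s → (∀ t → t < length xs → code (s + t) ≡ lookupOr pStop xs t) →
                  length xs + s ≤ N → CodeAt s xs (length xs + s)
  CodeAt-lookup [] s _ bound = [] bound
  CodeAt-lookup (x ∷ xs) s codes bound =
    subst (λ z → code z ≡ x) (+-identityʳ s) (codes 0 (s≤s z≤n)) ∷
    subst (CodeAt (suc s) xs) (+-suc (length xs) s)
      (CodeAt-lookup xs (suc s) (λ t t< → subst (λ z → code z ≡ lookupOr pStop xs t) (+-suc s t) (codes (suc t) (s≤s t<)))
                     (≤-trans (≤-reflexive (+-suc (length xs) s)) bound))

  opaque
    unfolding code N
    code-prologue : ∀ p → p < base → code p ≡ lookupOr pStop prologue p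
    code-prologue p p<base with p <? base
    ... | yes _ = refl
    ... | no p≮base = ⊥-elim (p≮base p<base)

    base≤N : base ≤ N
    base≤N = m≤m+n base _

    blockInstr-toℕ : ∀ (ℓ : Fin (suc L)) t → blockInstr (toℕ ℓ) t ≡ lookupOr pStop (block ℓ) t
    blockInstr-toℕ ℓ t with toℕ ℓ <? suc L
    ... | yes ℓ<1+L = cong (λ ℓ′ → lookupOr pStop (block ℓ′) t) (FinP.fromℕ<-toℕ ℓ ℓ<1+L)
    ... | no ℓ≮1+L = ⊥-elim (ℓ≮1+L (FinP.toℕ<n ℓ))

    code-block : ∀ (ℓ : Fin (suc L)) t → t < B → code (blockStart (toℕ ℓ) + t) ≡ lookupOr pStop (block ℓ) t
    code-block ℓ t t<B with blockStart (toℕ ℓ) + t <? base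
    ... | yes p<base = ⊥-elim (<-irrefl refl (<-≤-trans p<base (≤-trans (m≤m+n base _) (m≤m+n _ t))))
    ... | no _ rewrite +-assoc base (toℕ ℓ * B) t | m+n∸m≡n base (toℕ ℓ * B + t)
                     | [m*n+o]/n≡m (toℕ ℓ) t<B | [m*n+o]%n≡o (toℕ ℓ) t<B = blockInstr-toℕ ℓ t

    block-end : ∀ (ℓ : Fin (suc L)) m → m ≤ B → m + blockStart (toℕ ℓ) ≤ N
    block-end ℓ m m≤B = begin
        m + (base + toℕ ℓ * B)  ≡⟨ +-comm m _ ⟩
        base + toℕ ℓ * B + m    ≡⟨ +-assoc base _ m ⟩
        base + (toℕ ℓ * B + m)  ≤⟨ +-monoʳ-≤ base (+-monoʳ-≤ (toℕ ℓ * B) m≤B) ⟩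
        base + (toℕ ℓ * B + B)  ≡⟨ cong (base +_) (+-comm (toℕ ℓ * B) B) ⟩
        base + suc (toℕ ℓ) * B  ≤⟨ +-monoʳ-≤ base (*-monoˡ-≤ B (FinP.toℕ<n ℓ)) ⟩
        N ∎
      where open ≤-Reasoning

  CodeAt-prologue : length prologue ≡ base → CodeAt 0 prologue base
  CodeAt-prologue len = subst (CodeAt 0 prologue) (trans (+-identityʳ _) len)
    (CodeAt-lookup prologue 0 (λ t t< → code-prologue t (subst (t <_) len t<)) (≤-trans (≤-reflexive (trans (+-identityʳ _) len)) base≤N))

  CodeAt-block : ∀ (ℓ : Fin (suc L)) → length (block ℓ) ≤ B →
                 CodeAt (blockStart (toℕ ℓ)) (block ℓ) (length (block ℓ) + blockStart (toℕ ℓ))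
  CodeAt-block ℓ len≤B = CodeAt-lookup (block ℓ) (blockStart (toℕ ℓ)) (λ t t< → code-block ℓ t (<-≤-trans t< len≤B)) (block-end ℓ _ len≤B)

data TraceInstr (A : Structure) : Set where
  tOp    : (i : Fin (Structure.nf A)) → ℕ → Vec ℕ (Structure.arity A i) → TraceInstr A
  tConst : ℕ → Fin (Structure.nc A) → TraceInstr A
  tCopy  : ℕ → ℕ → TraceInstr A
  tRel   : (i : Fin (Structure.nr A)) → Vec ℕ (Structure.rarity A i) → Bool → TraceInstr A

false≢true : false ≢ true
false≢true ()

map-agree : ∀ {X : Set} {n K} {Z Z′ : ℕ → X} (as : Vec ℕ n) → All (_< K) (Vec.toList as) →
            (∀ j → j < K → Z j ≡ Z′ j) → Vec.map Z as ≡ Vec.map Z′ as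
map-agree [] [] _ = refl
map-agree (j ∷ as) (j<K ∷ as<K) Z≈Z′ = cong₂ _∷_ (Z≈Z′ j j<K) (map-agree as as<K Z≈Z′)

-- Replaying a recorded run on other register contents either reaches its end, and then
-- the machine halts from those contents too, or leaves it at a test with a different
-- outcome, which requires the contents to differ on the registers the run touches.
module Trace (A : Structure) where
  open Structure A
  open MachineFacts A

  registers : TraceInstr A → List ℕ
  registers (tOp i j as) = j ∷ Vec.toList as
  registers (tConst j c) = j ∷ []
  registers (tCopy j j′) = j ∷ j′ ∷ []
  registers (tRel i as b) = Vec.toList as

  RegistersBelow : ℕ → List (TraceInstr A) → Set
  RegistersBelow K = All (λ x → All (_< K) (registers x))

  registersBelow-concat : ∀ {K} tr → All (_< K) (List.concatMap registers tr) → RegistersBelow K tr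
  registersBelow-concat [] _ = []
  registersBelow-concat (x ∷ tr) bound with ++⁻ (registers x) bound
  ... | x<K , tr<K = x<K ∷ registersBelow-concat tr tr<K

  module _ (P : Program A det) where
    traceStep : ∀ {c d} → Step A P (NoOracle A) c d → List (TraceInstr A)
    traceStep (s-op {i = i} {j = j} {as = as} _ _) = tOp i j as ∷ []
    traceStep (s-const {j = j} {i = i} _ _) = tConst j i ∷ []
    traceStep (s-copy {j = j} {j' = j′} _ _) = tCopy j j′ ∷ []
    traceStep (s-icopy {I = I} {a = a} {b = b} _ _) = tCopy (I a) (I b) ∷ []
    traceStep (s-one _ _) = []
    traceStep (s-inc _ _) = []
    traceStep (s-relT {i = i} {as = as} _ _) = tRel i as true ∷ []
    traceStep (s-relF {i = i} {as = as} _ _) = tRel i as false ∷ []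
    traceStep (s-idxT _ _) = []
    traceStep (s-idxF _ _) = []
    traceStep (s-ch₁ {e = ()} _)
    traceStep (s-ch₂ {e = ()} _)
    traceStep (s-nu {e = ()} _ _ _ _)

    trace : ∀ {c d} → Star (Step A P (NoOracle A)) c d → List (TraceInstr A)
    trace ε = []
    trace (s ◅ ss) = traceStep s ++ trace ss

  -- A test with an outcome other than the recorded one jumps to F.
  module _ {k : ℕ} where
    compileInstr : ℕ → ℕ → TraceInstr A → AsmInstr A k
    compileInstr s F (tOp i j as) = pOp i j as
    compileInstr s F (tConst j c) = pConst j c
    compileInstr s F (tCopy j j′) = pCopy j j′
    compileInstr s F (tRel i as true) = pRel i as (suc s) F
    compileInstr s F (tRel i as false) = pRel i as F (suc s)

    compileTrace : ℕ → ℕ → List (TraceInstr A) → List (AsmInstr A k)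
    compileTrace s F [] = []
    compileTrace s F (x ∷ xs) = compileInstr s F x ∷ compileTrace (suc s) F xs

    length-compileTrace : ∀ s F xs → length (compileTrace s F xs) ≡ length xs
    length-compileTrace s F [] = refl
    length-compileTrace s F (x ∷ xs) = cong suc (length-compileTrace (suc s) F xs)

  AgreeBelow : ℕ → (ℕ → U) → (ℕ → U) → Set
  AgreeBelow K X Y = ∀ j → j < K → X j ≡ Y j

  AgreeFrom : ℕ → (ℕ → U) → (ℕ → U) → Set
  AgreeFrom K X Y = ∀ j → K ≤ j → X j ≡ Y j

  AgreeFrom-trans : ∀ {K X Y W} → AgreeFrom K X Y → AgreeFrom K Y W → AgreeFrom K X W
  AgreeFrom-trans X≈Y Y≈W j K≤j = trans (X≈Y j K≤j) (Y≈W j K≤j)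

  AgreeBelow-upd : ∀ {K} {X Y : ℕ → U} j {x y} → AgreeBelow K X Y → x ≡ y → AgreeBelow K (updZ A X j x) (updZ A Y j y)
  AgreeBelow-upd j X≈Y x≡y m m<K with j ≡ᵇ m
  ... | true = x≡y
  ... | false = X≈Y m m<K

  AgreeFrom-upd : ∀ {K} (X : ℕ → U) {j} y → j < K → AgreeFrom K (updZ A X j y) X
  AgreeFrom-upd X {j} y j<K m K≤m = updZ-other X j y m (λ j≡m → <-irrefl j≡m (<-≤-trans j<K K≤m))

  module Replay (k N : ℕ) (code : ℕ → AsmInstr A k) (Q : Subset∞ U) (K F : ℕ) where
    open Assembly A k N code

    Reaches : ℕ → ℕ → (ℕ → U) → (Fin (suc k) → ℕ) → Set
    Reaches s t Z I₂ = Σ (ℕ → U) λ Z′ → AgreeFrom K Z′ Z × Star (Move Q) ⟨ label s , Z , I₂ ⟩ ⟨ label t , Z′ , I₂ ⟩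

    module _ (P : Program A det) where
      open Program P renaming (L to L₁; k to k₁)

      Run : Config A L₁ k₁ → Config A L₁ k₁ → Set
      Run = Star (Step A P (NoOracle A))

      HaltsFrom : Config A L₁ k₁ → Set
      HaltsFrom c = ∃ λ f → Run c f × Stopped A P f

      ReplayOutcome : ℕ → ℕ → (ℕ → U) → (Fin (suc k) → ℕ) → Config A L₁ k₁ → (ℕ → U) → Set
      ReplayOutcome s e Z I₂ c Zc = (Reaches s e Z I₂ × HaltsFrom c) ⊎ (Reaches s F Z I₂ × ¬ AgreeBelow K (Config.reg c) Zc)

      ReplayOutcome-cons : ∀ {s s′ e Z Z′ I₂ c c′ Zc Zc′} →
                     Star (Move Q) ⟨ label s , Z , I₂ ⟩ ⟨ label s′ , Z′ , I₂ ⟩ → AgreeFrom K Z′ Z →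
                     Step A P (NoOracle A) c c′ → (AgreeBelow K (Config.reg c) Zc → AgreeBelow K (Config.reg c′) Zc′) →
                     ReplayOutcome s′ e Z′ I₂ c′ Zc′ → ReplayOutcome s e Z I₂ c Zc
      ReplayOutcome-cons path Z′≈Z step _ (inj₁ ((Z″ , Z″≈Z′ , path′) , f , run , stop)) =
        inj₁ ((Z″ , AgreeFrom-trans Z″≈Z′ Z′≈Z , path ◅◅ path′) , f , step ◅ run , stop)
      ReplayOutcome-cons path Z′≈Z step preserve (inj₂ ((Z″ , Z″≈Z′ , path′) , disagree)) =
        inj₂ ((Z″ , AgreeFrom-trans Z″≈Z′ Z′≈Z , path ◅◅ path′) , λ agree → disagree (preserve agree))

      replay : ∀ {ℓ Zc I f} (run : Run ⟨ ℓ , Zc , I ⟩ f) → Stopped A P f → ∀ {s e} Ze Z I₂ →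
               CodeAt s (compileTrace s F (trace P run)) e → RegistersBelow K (trace P run) →
               AgreeBelow K Z Ze → ReplayOutcome s e Z I₂ ⟨ ℓ , Ze , I ⟩ Zc
      replay ε stop Ze Z I₂ ([] _) _ _ = inj₁ ((Z , (λ _ _ → refl) , ε) , _ , ε , stop)
      replay (s-op {i = i} {j = j} {as = as} eq p ◅ run) stop Ze Z I₂ (c ∷ at) ((j<K ∷ as<K) ∷ bound) Z≈Ze =
        ReplayOutcome-cons (straight-step Q Z I₂ (CodeAt-≤ at) c opS ◅ ε) (AgreeFrom-upd Z _ j<K) (s-op eq p)
          (λ Ze≈Zc → AgreeBelow-upd j Ze≈Zc (cong (op i) (map-agree as as<K Ze≈Zc)))
          (replay run stop _ _ I₂ at bound (AgreeBelow-upd j Z≈Ze (cong (op i) (map-agree as as<K Z≈Ze))))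
      replay (s-const {j = j} eq p ◅ run) stop Ze Z I₂ (c ∷ at) ((j<K ∷ []) ∷ bound) Z≈Ze =
        ReplayOutcome-cons (straight-step Q Z I₂ (CodeAt-≤ at) c constS ◅ ε) (AgreeFrom-upd Z _ j<K) (s-const eq p)
          (λ Ze≈Zc → AgreeBelow-upd j Ze≈Zc refl)
          (replay run stop _ _ I₂ at bound (AgreeBelow-upd j Z≈Ze refl))
      replay (s-copy {j = j} {j' = j′} eq p ◅ run) stop Ze Z I₂ (c ∷ at) ((j<K ∷ j′<K ∷ []) ∷ bound) Z≈Ze =
        ReplayOutcome-cons (straight-step Q Z I₂ (CodeAt-≤ at) c copyS ◅ ε) (AgreeFrom-upd Z _ j<K) (s-copy eq p)
          (λ Ze≈Zc → AgreeBelow-upd j Ze≈Zc (Ze≈Zc j′ j′<K))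
          (replay run stop _ _ I₂ at bound (AgreeBelow-upd j Z≈Ze (Z≈Ze j′ j′<K)))
      replay (s-icopy {I = I} {a = a} {b = b} eq p ◅ run) stop Ze Z I₂ (c ∷ at) ((j<K ∷ j′<K ∷ []) ∷ bound) Z≈Ze =
        ReplayOutcome-cons (straight-step Q Z I₂ (CodeAt-≤ at) c copyS ◅ ε) (AgreeFrom-upd Z _ j<K) (s-icopy eq p)
          (λ Ze≈Zc → AgreeBelow-upd (I a) Ze≈Zc (Ze≈Zc (I b) j′<K))
          (replay run stop _ _ I₂ at bound (AgreeBelow-upd (I a) Z≈Ze (Z≈Ze (I b) j′<K)))
      replay (s-one eq p ◅ run) stop Ze Z I₂ at bound Z≈Ze =
        ReplayOutcome-cons ε (λ _ _ → refl) (s-one eq p) (λ Ze≈Zc → Ze≈Zc) (replay run stop Ze Z I₂ at bound Z≈Ze)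
      replay (s-inc eq p ◅ run) stop Ze Z I₂ at bound Z≈Ze =
        ReplayOutcome-cons ε (λ _ _ → refl) (s-inc eq p) (λ Ze≈Zc → Ze≈Zc) (replay run stop Ze Z I₂ at bound Z≈Ze)
      replay (s-idxT eq e ◅ run) stop Ze Z I₂ at bound Z≈Ze =
        ReplayOutcome-cons ε (λ _ _ → refl) (s-idxT eq e) (λ Ze≈Zc → Ze≈Zc) (replay run stop Ze Z I₂ at bound Z≈Ze)
      replay (s-idxF eq e ◅ run) stop Ze Z I₂ at bound Z≈Ze =
        ReplayOutcome-cons ε (λ _ _ → refl) (s-idxF eq e) (λ Ze≈Zc → Ze≈Zc) (replay run stop Ze Z I₂ at bound Z≈Ze)
      replay (s-relT {i = i} {as = as} eq r ◅ run) stop Ze Z I₂ (c ∷ at) (as<K ∷ bound) Z≈Ze with rel i (Vec.map Z as) in rZ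
      ... | true =
        ReplayOutcome-cons (rel-true-step Q Z I₂ (CodeAt-≤ at) c rZ ◅ ε) (λ _ _ → refl)
          (s-relT eq (trans (cong (rel i) (sym (map-agree as as<K Z≈Ze))) rZ)) (λ Ze≈Zc → Ze≈Zc)
          (replay run stop Ze Z I₂ at bound Z≈Ze)
      ... | false = inj₂ ((Z , (λ _ _ → refl) , rel-false-step Q Z I₂ (CodeAt-≤ at) c rZ ◅ ε) ,
          λ Ze≈Zc → false≢true (trans (sym rZ) (trans (cong (rel i) (trans (map-agree as as<K Z≈Ze) (map-agree as as<K Ze≈Zc))) r)))
      replay (s-relF {i = i} {as = as} eq r ◅ run) stop Ze Z I₂ (c ∷ at) (as<K ∷ bound) Z≈Ze with rel i (Vec.map Z as) in rZ
      ... | false =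
        ReplayOutcome-cons (rel-false-step Q Z I₂ (CodeAt-≤ at) c rZ ◅ ε) (λ _ _ → refl)
          (s-relF eq (trans (cong (rel i) (sym (map-agree as as<K Z≈Ze))) rZ)) (λ Ze≈Zc → Ze≈Zc)
          (replay run stop Ze Z I₂ at bound Z≈Ze)
      ... | true = inj₂ ((Z , (λ _ _ → refl) , rel-true-step Q Z I₂ (CodeAt-≤ at) c rZ ◅ ε) ,
          λ Ze≈Zc → false≢true (trans (sym r) (trans (cong (rel i) (trans (sym (map-agree as as<K Ze≈Zc)) (sym (map-agree as as<K Z≈Ze)))) rZ)))
      replay (s-ch₁ {e = ()} _ ◅ _) stop Ze Z I₂ at bound Z≈Ze
      replay (s-ch₂ {e = ()} _ ◅ _) stop Ze Z I₂ at bound Z≈Ze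
      replay (s-nu {e = ()} _ _ _ _ ◅ _) stop Ze Z I₂ at bound Z≈Ze

    Exit : ℕ → ℕ → Cfg → (ℕ → U) → (Fin (suc k) → ℕ) → Set
    Exit n e f Z I₂ = Σ (ℕ → U) λ Z′ → AgreeFrom K Z′ Z × Σ ℕ λ m → m ≤ n ×
                        (Steps (Move Q) m ⟨ label e , Z′ , I₂ ⟩ f ⊎ Steps (Move Q) m ⟨ label F , Z′ , I₂ ⟩ f)

    Exit-weaken : ∀ {m n e f Z Z′ I₂} → m ≤ n → AgreeFrom K Z′ Z → Exit m e f Z′ I₂ → Exit n e f Z I₂
    Exit-weaken m≤n Z′≈Z (Z″ , Z″≈Z′ , m′ , m′≤m , rest) = Z″ , AgreeFrom-trans Z″≈Z′ Z′≈Z , m′ , ≤-trans m′≤m m≤n , rest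

    replay⁻¹ : ∀ tr {s e n f} Z I₂ → CodeAt s (compileTrace s F tr) e → RegistersBelow K tr →
               Steps (Move Q) n ⟨ label s , Z , I₂ ⟩ f → Halted Q f → Exit n e f Z I₂
    replay⁻¹ [] Z I₂ ([] _) _ ss stop = Z , (λ _ _ → refl) , _ , ≤-refl , inj₁ ss
    replay⁻¹ (tOp i j as ∷ tr) Z I₂ (c ∷ at) ((j<K ∷ _) ∷ bound) ss stop with straight-steps⁻¹ Q (CodeAt-≤ at) c opS ss stop
    ... | m , m<n , rest = Exit-weaken (<⇒≤ m<n) (AgreeFrom-upd Z _ j<K) (replay⁻¹ tr _ I₂ at bound rest stop)
    replay⁻¹ (tConst j x ∷ tr) Z I₂ (c ∷ at) ((j<K ∷ _) ∷ bound) ss stop with straight-steps⁻¹ Q (CodeAt-≤ at) c constS ss stop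
    ... | m , m<n , rest = Exit-weaken (<⇒≤ m<n) (AgreeFrom-upd Z _ j<K) (replay⁻¹ tr _ I₂ at bound rest stop)
    replay⁻¹ (tCopy j j′ ∷ tr) Z I₂ (c ∷ at) ((j<K ∷ _) ∷ bound) ss stop with straight-steps⁻¹ Q (CodeAt-≤ at) c copyS ss stop
    ... | m , m<n , rest = Exit-weaken (<⇒≤ m<n) (AgreeFrom-upd Z _ j<K) (replay⁻¹ tr _ I₂ at bound rest stop)
    replay⁻¹ (tRel i as true ∷ tr) Z I₂ (c ∷ at) (_ ∷ bound) ss stop with rel-steps⁻¹ Q (CodeAt-≤ at) c ss stop
    ... | m , m<n , inj₁ (_ , rest) = Exit-weaken (<⇒≤ m<n) (λ _ _ → refl) (replay⁻¹ tr Z I₂ at bound rest stop)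
    ... | m , m<n , inj₂ (_ , rest) = Z , (λ _ _ → refl) , m , <⇒≤ m<n , inj₂ rest
    replay⁻¹ (tRel i as false ∷ tr) Z I₂ (c ∷ at) (_ ∷ bound) ss stop with rel-steps⁻¹ Q (CodeAt-≤ at) c ss stop
    ... | m , m<n , inj₁ (_ , rest) = Z , (λ _ _ → refl) , m , <⇒≤ m<n , inj₂ rest
    ... | m , m<n , inj₂ (_ , rest) = Exit-weaken (<⇒≤ m<n) (λ _ _ → refl) (replay⁻¹ tr Z I₂ at bound rest stop)

module BlockMoves (A : Structure) (k : ℕ) where
  open Structure A
  open MachineFacts A
  open StraightLine A k

  copyBlock : Fin (suc k) → Fin (suc k) → ℕ → List (AsmInstr A k)
  copyBlock a b zero = []
  copyBlock a b (suc n) = pICopy a b ∷ pInc a ∷ pInc b ∷ copyBlock a b n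

  fillBlock : Fin (suc k) → Fin (suc k) → ℕ → List (AsmInstr A k)
  fillBlock a b zero = []
  fillBlock a b (suc n) = pICopy a b ∷ pInc a ∷ fillBlock a b n

  spread : ℕ → List (AsmInstr A k)
  spread zero = []
  spread (suc n) = pCopy (suc n) 0 ∷ spread n

  copyBlock-straight : ∀ a b n → All Straight (copyBlock a b n)
  copyBlock-straight a b zero = []
  copyBlock-straight a b (suc n) = icopyS ∷ incS ∷ incS ∷ copyBlock-straight a b n

  fillBlock-straight : ∀ a b n → All Straight (fillBlock a b n)
  fillBlock-straight a b zero = []
  fillBlock-straight a b (suc n) = icopyS ∷ incS ∷ fillBlock-straight a b n

  spread-straight : ∀ n → All Straight (spread n)
  spread-straight zero = []
  spread-straight (suc n) = copyS ∷ spread-straight n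

  Outside : ℕ → ℕ → ℕ → Set
  Outside d n j = j < d ⊎ d + n ≤ j

  Outside-suc : ∀ {d n j} → Outside d (suc n) j → Outside (suc d) n j ⊎ j ≡ d
  Outside-suc {d} {n} {j} (inj₁ j<d) = inj₁ (inj₁ (≤-trans j<d (n≤1+n _)))
  Outside-suc {d} {n} {j} (inj₂ d+1+n≤j) = inj₁ (inj₂ (≤-trans (≤-reflexive (sym (+-suc d n))) d+1+n≤j))

  Outside-≢ : ∀ {d n j} → Outside d (suc n) j → d ≢ j
  Outside-≢ (inj₁ j<d) = >⇒≢ j<d
  Outside-≢ {d} (inj₂ d+1+n≤j) = <⇒≢ (<-≤-trans (m<m+n d (s≤s z≤n)) d+1+n≤j)

  record CopiedBlock (n : ℕ) (a b : Fin (suc k)) (Z : ℕ → U) (I : Fin (suc k) → ℕ) (d s : ℕ)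
                     (Z′ : ℕ → U) (I′ : Fin (suc k) → ℕ) : Set where
    field
      moved : ∀ u → u < n → Z′ (d + u) ≡ Z (s + u)
      kept  : ∀ j → Outside d n j → Z′ j ≡ Z j
      at-a  : I′ a ≡ d + n
      at-b  : I′ b ≡ s + n
      other : ∀ c → c ≢ a → c ≢ b → I′ c ≡ I c

  copyBlock-spec : ∀ n a b → a ≢ b → ∀ Z I d s → I a ≡ d → I b ≡ s → (s + n ≤ d ⊎ d + n ≤ s) →
                   CopiedBlock n a b Z I d s (runZ (copyBlock a b n) Z I) (runI (copyBlock a b n) Z I)
  copyBlock-spec zero a b a≢b Z I d s Ia≡d Ib≡s disjoint = record
    { moved = λ _ () ; kept = λ _ _ → refl
    ; at-a = trans Ia≡d (sym (+-identityʳ d)) ; at-b = trans Ib≡s (sym (+-identityʳ s)) ; other = λ _ _ _ → refl }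
  copyBlock-spec (suc n) a b a≢b Z I d s Ia≡d Ib≡s disjoint =
    record { moved = moved ; kept = kept ; at-a = at-a ; at-b = at-b ; other = other }
    where
      Z₁ = updZ A Z (I a) (Z (I b))
      I₁ = updI A I a (suc (I a))
      I₂ = updI A I₁ b (suc (I₁ b))
      I₂a : I₂ a ≡ suc d
      I₂a = trans (updI-other I₁ b _ a (≢-sym a≢b)) (trans (updI-same I a _) (cong suc Ia≡d))
      I₂b : I₂ b ≡ suc s
      I₂b = trans (updI-same I₁ b _) (cong suc (trans (updI-other I a _ b a≢b) Ib≡s))
      shift : (s + suc n ≤ d ⊎ d + suc n ≤ s) → (suc s + n ≤ suc d) ⊎ (suc d + n ≤ suc s)
      shift (inj₁ s+1+n≤d) = inj₁ (s≤s (≤-trans (n≤1+n _) (≤-trans (≤-reflexive (sym (+-suc s n))) s+1+n≤d)))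
      shift (inj₂ d+1+n≤s) = inj₂ (s≤s (≤-trans (n≤1+n _) (≤-trans (≤-reflexive (sym (+-suc d n))) d+1+n≤s)))
      module IH = CopiedBlock (copyBlock-spec n a b a≢b Z₁ I₂ (suc d) (suc s) I₂a I₂b (shift disjoint))
      Z₁d : Z₁ d ≡ Z s
      Z₁d = trans (cong (λ x → updZ A Z x (Z (I b)) d) Ia≡d) (trans (updZ-same Z d _) (cong Z Ib≡s))
      Z₁-other : ∀ j → d ≢ j → Z₁ j ≡ Z j
      Z₁-other j d≢j = trans (cong (λ x → updZ A Z x (Z (I b)) j) Ia≡d) (updZ-other Z d _ j d≢j)
      source-outside : (s + suc n ≤ d ⊎ d + suc n ≤ s) → ∀ u → u < n → Outside d (suc n) (suc (s + u))
      source-outside (inj₁ s+1+n≤d) u u<n = inj₁ (<-≤-trans (s≤s (+-monoʳ-< s u<n)) (≤-trans (≤-reflexive (sym (+-suc s n))) s+1+n≤d))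
      source-outside (inj₂ d+1+n≤s) u u<n = inj₂ (≤-trans d+1+n≤s (≤-trans (m≤m+n s u) (n≤1+n _)))
      Z′ = runZ (copyBlock a b n) Z₁ I₂
      kept : ∀ j → Outside d (suc n) j → Z′ j ≡ Z j
      kept j out with Outside-suc out
      ... | inj₁ out′ = trans (IH.kept j out′) (Z₁-other j (Outside-≢ out))
      ... | inj₂ refl = ⊥-elim (Outside-≢ out refl)
      moved : ∀ u → u < suc n → Z′ (d + u) ≡ Z (s + u)
      moved zero _ rewrite +-identityʳ d | +-identityʳ s = trans (IH.kept d (inj₁ ≤-refl)) Z₁d
      moved (suc u) (s≤s u<n) rewrite +-suc d u | +-suc s u =
        trans (IH.moved u u<n) (Z₁-other _ (Outside-≢ (source-outside disjoint u u<n)))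
      at-a : runI (copyBlock a b n) Z₁ I₂ a ≡ d + suc n
      at-a = trans IH.at-a (sym (+-suc d n))
      at-b : runI (copyBlock a b n) Z₁ I₂ b ≡ s + suc n
      at-b = trans IH.at-b (sym (+-suc s n))
      other : ∀ c → c ≢ a → c ≢ b → runI (copyBlock a b n) Z₁ I₂ c ≡ I c
      other c c≢a c≢b = trans (IH.other c c≢a c≢b) (trans (updI-other I₁ b _ c (≢-sym c≢b)) (updI-other I a _ c (≢-sym c≢a)))

  record FilledBlock (n : ℕ) (a : Fin (suc k)) (Z : ℕ → U) (I : Fin (suc k) → ℕ) (d h : ℕ)
                     (Z′ : ℕ → U) (I′ : Fin (suc k) → ℕ) : Set where
    field
      filled : ∀ u → u < n → Z′ (d + u) ≡ Z h
      kept   : ∀ j → Outside d n j → Z′ j ≡ Z j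
      at-a   : I′ a ≡ d + n
      other  : ∀ c → c ≢ a → I′ c ≡ I c

  fillBlock-spec : ∀ n a b → a ≢ b → ∀ Z I d h → I a ≡ d → I b ≡ h → Outside d n h →
                   FilledBlock n a Z I d h (runZ (fillBlock a b n) Z I) (runI (fillBlock a b n) Z I)
  fillBlock-spec zero a b a≢b Z I d h Ia≡d Ib≡h h-out = record
    { filled = λ _ () ; kept = λ _ _ → refl ; at-a = trans Ia≡d (sym (+-identityʳ d)) ; other = λ _ _ → refl }
  fillBlock-spec (suc n) a b a≢b Z I d h Ia≡d Ib≡h h-out =
    record { filled = filled ; kept = kept ; at-a = trans IH.at-a (sym (+-suc d n)) ; other = other }
    where
      Z₁ = updZ A Z (I a) (Z (I b))
      I₁ = updI A I a (suc (I a))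
      I₁a : I₁ a ≡ suc d
      I₁a = trans (updI-same I a _) (cong suc Ia≡d)
      I₁b : I₁ b ≡ h
      I₁b = trans (updI-other I a _ b a≢b) Ib≡h
      shift : ∀ {j} → Outside d (suc n) j → Outside (suc d) n j
      shift out with Outside-suc out
      ... | inj₁ out′ = out′
      ... | inj₂ refl = ⊥-elim (Outside-≢ out refl)
      module IH = FilledBlock (fillBlock-spec n a b a≢b Z₁ I₁ (suc d) h I₁a I₁b (shift h-out))
      Z₁d : Z₁ d ≡ Z h
      Z₁d = trans (cong (λ x → updZ A Z x (Z (I b)) d) Ia≡d) (trans (updZ-same Z d _) (cong Z Ib≡h))
      Z₁-other : ∀ j → d ≢ j → Z₁ j ≡ Z j
      Z₁-other j d≢j = trans (cong (λ x → updZ A Z x (Z (I b)) j) Ia≡d) (updZ-other Z d _ j d≢j)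
      Z′ = runZ (fillBlock a b n) Z₁ I₁
      filled : ∀ u → u < suc n → Z′ (d + u) ≡ Z h
      filled zero _ rewrite +-identityʳ d = trans (IH.kept d (inj₁ ≤-refl)) Z₁d
      filled (suc u) (s≤s u<n) rewrite +-suc d u = trans (IH.filled u u<n) (Z₁-other h (Outside-≢ h-out))
      kept : ∀ j → Outside d (suc n) j → Z′ j ≡ Z j
      kept j out = trans (IH.kept j (shift out)) (Z₁-other j (Outside-≢ out))
      other : ∀ c → c ≢ a → runI (fillBlock a b n) Z₁ I₁ c ≡ I c
      other c c≢a = trans (IH.other c c≢a) (updI-other I a _ c (≢-sym c≢a))

  spread-spec : ∀ n Z I → (∀ j → j ≤ n → runZ (spread n) Z I j ≡ Z 0) × (∀ j → n < j → runZ (spread n) Z I j ≡ Z j)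
                          × runI (spread n) Z I ≡ I
  spread-spec zero Z I = (λ { zero _ → refl ; (suc j) () }) , (λ _ _ → refl) , refl
  spread-spec (suc n) Z I = low , high , proj₂ (proj₂ IH)
    where
      Z₁ = updZ A Z (suc n) (Z 0)
      IH = spread-spec n Z₁ I
      low : ∀ j → j ≤ suc n → runZ (spread n) Z₁ I j ≡ Z 0
      low j j≤1+n with m≤n⇒m<n∨m≡n j≤1+n
      ... | inj₁ j<1+n = trans (proj₁ IH j (≤-pred j<1+n)) (updZ-other Z (suc n) (Z 0) 0 (λ ()))
      ... | inj₂ refl = trans (proj₁ (proj₂ IH) (suc n) ≤-refl) (updZ-same Z (suc n) _)
      high : ∀ j → suc n < j → runZ (spread n) Z₁ I j ≡ Z j
      high j 1+n<j = trans (proj₁ (proj₂ IH) j (≤-trans (n≤1+n _) 1+n<j)) (updZ-other Z (suc n) _ j (<⇒≢ 1+n<j))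

module Simulation (A : Structure) (i₁ i₂ : Fin (Structure.nc A)) (c₁≢c₂ : Structure.const A i₁ ≢ Structure.const A i₂)
                  (P : Program A det) (P-semidecides : ∀ x → (⟦ Structure.const A i₁ ⟧₁ x ⇔ Halts A P x))
                  (M : Program A ndb) where
  open Structure A
  open MachineFacts A
  open Trace A

  c₁ c₂ : U
  c₁ = const i₁
  c₂ = const i₂

  Q : Subset∞ U
  Q = Pairs A c₁ c₂

  P-halts-on-c₁ : Halts A P (0 , c₁ ∷ [])
  P-halts-on-c₁ = Equivalence.to (P-semidecides _) refl

  P-diverges-on-c₂ : ¬ Halts A P (0 , c₂ ∷ [])
  P-diverges-on-c₂ halts = c₁≢c₂ (sym (cong (λ x → Vec.head (proj₂ x)) (Equivalence.from (P-semidecides _) halts)))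

  recordedRun : Star (Step A P (NoOracle A)) (initial A P (0 , c₁ ∷ [])) (proj₁ P-halts-on-c₁)
  recordedRun = proj₁ (proj₂ P-halts-on-c₁)

  recorded : List (TraceInstr A)
  recorded = trace P recordedRun

  maxReg : ℕ
  maxReg = max 0 (List.concatMap registers recorded)

  K : ℕ
  K = suc maxReg

  recorded-below : RegistersBelow K recorded
  recorded-below = registersBelow-concat recorded (All.map s≤s (xs≤max 0 _))

  L k k′ : ℕ
  L = Program.L M
  k = Program.k M
  k′ = k + 4

  ⇑ : Fin (suc k) → Fin (suc k′)
  ⇑ a = a ↑ˡ 4

  -- Fresh index registers. In a simulating configuration the first three all hold the
  -- frontier G, beyond which every register of M holds the same value.
  jSave jRestore jFill jLow : Fin (suc k′)
  jSave = suc k ↑ʳ Fin.zero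
  jRestore = suc k ↑ʳ Fin.suc Fin.zero
  jFill = suc k ↑ʳ Fin.suc (Fin.suc Fin.zero)
  jLow = suc k ↑ʳ Fin.suc (Fin.suc (Fin.suc Fin.zero))

  writtenReg : Instr A ndb L k → ℕ
  writtenReg (opI i j as) = j
  writtenReg (constI j c) = j
  writtenReg (copyI j j′) = j
  writtenReg _ = 0

  maxWritten : ℕ
  maxWritten = max 0 (List.tabulate (λ ℓ → writtenReg (Program.body M ℓ)))

  writtenReg≤maxWritten : ∀ ℓ → writtenReg (Program.body M ℓ) ≤ maxWritten
  writtenReg≤maxWritten ℓ = All.lookup (xs≤max 0 _) (∈-tabulate⁺ {f = λ ℓ′ → writtenReg (Program.body M ℓ′)} ℓ)

  open StraightLine A k′
  open BlockMoves A k′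

  jump : ℕ → AsmInstr A k′
  jump = goto jSave

  bumpCode : List (AsmInstr A k′)
  bumpCode = pInc jSave ∷ pInc jRestore ∷ pInc jFill ∷ []

  bumpFrontier : ℕ → List (AsmInstr A k′)
  bumpFrontier zero = []
  bumpFrontier (suc n) = bumpCode ++ bumpFrontier n

  incrementCode : Fin (suc k) → List (AsmInstr A k′)
  incrementCode a = pInc (⇑ a) ∷ bumpCode

  margin : ℕ
  margin = K + maxWritten

  -- Raise the frontier to the input length, then by margin + 1 more.
  prologue : List (AsmInstr A k′)
  prologue = pIdx jSave (⇑ Fin.zero) 5 1 ∷ bumpCode ++ jump 0 ∷ bumpFrontier (suc margin)

  base : ℕ
  base = length prologue

  opaque
    saveCode : List (AsmInstr A k′)
    saveCode = pOne jLow ∷ copyBlock jSave jLow K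

  -- ν needs its argument in {c₁, c₂}. The guess is spread over registers [0, K), as in the
  -- initial configuration of P on the input (y).
  guessCode : List (AsmInstr A k′)
  guessCode = pConst 0 i₁ ∷ pNu 0 (0 ∷ []) ∷ spread maxReg

  opaque
    restoreCode : List (AsmInstr A k′)
    restoreCode = pOne jLow ∷ (copyBlock jLow jRestore K ++ fillBlock jFill jSave K)

  opaque
    unfolding saveCode
    4≤length-saveCode : 4 ≤ length saveCode
    4≤length-saveCode = s≤s (s≤s (s≤s (s≤s z≤n)))

  B : ℕ
  B = length saveCode + (length guessCode + (length recorded + ((length restoreCode + 1) + (length restoreCode + 1))))

  instance
    B-nonZero : NonZero B
    B-nonZero = >-nonZero (≤-trans (≤-trans (s≤s z≤n) 4≤length-saveCode) (m≤m+n _ _))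

  traceStart successStart failStart : ℕ → ℕ
  traceStart b = length guessCode + (length saveCode + b)
  successStart b = length recorded + traceStart b
  failStart b = suc (length restoreCode + successStart b)

  -- The block at address b simulating "goto t₁ or goto t₂": it saves registers [0, K) to
  -- [G, G + K), replays the recorded trace on a guessed value, copies the saved registers
  -- back and refills [G, G + K) from register G + K, which holds the common value of all
  -- registers of M from the frontier G on. The new frontier is G + K.
  choiceGadget : ℕ → ℕ → ℕ → List (AsmInstr A k′)
  choiceGadget b t₁ t₂ =
    saveCode ++ guessCode ++ compileTrace (traceStart b) (failStart b) recorded ++
      (restoreCode ++ jump t₁ ∷ []) ++ (restoreCode ++ jump t₂ ∷ [])

  start : Fin (suc L) → ℕ
  start ℓ = base + toℕ ℓ * B

  next : Fin (suc L) → ℕ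
  next ℓ = base + suc (toℕ ℓ) * B

  compileAt : Fin (suc L) → Instr A ndb L k → List (AsmInstr A k′)
  compileAt ℓ (opI i j as) = pOp i j as ∷ jump (next ℓ) ∷ []
  compileAt ℓ (constI j c) = pConst j c ∷ jump (next ℓ) ∷ []
  compileAt ℓ (copyI j j′) = pCopy j j′ ∷ jump (next ℓ) ∷ []
  compileAt ℓ (indCopyI a b) = pICopy (⇑ a) (⇑ b) ∷ jump (next ℓ) ∷ []
  compileAt ℓ (setOneI a) = pOne (⇑ a) ∷ jump (next ℓ) ∷ []
  compileAt ℓ (incI a) = incrementCode a ++ jump (next ℓ) ∷ []
  compileAt ℓ (relBrI i as ℓ₁ ℓ₂) = pRel i as (start ℓ₁) (start ℓ₂) ∷ []
  compileAt ℓ (idxBrI a b ℓ₁ ℓ₂) = pIdx (⇑ a) (⇑ b) (start ℓ₁) (start ℓ₂) ∷ []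
  compileAt ℓ stopI = pStop ∷ []
  compileAt ℓ (choiceI _ ℓ₁ ℓ₂) = choiceGadget (start ℓ) (start ℓ₁) (start ℓ₂)
  compileAt ℓ (nuI _ j as) = pStop ∷ []

  open Layout A k′ L base B prologue (λ ℓ → compileAt ℓ (Program.body M ℓ)) public

  M′ : Program A nu
  M′ = program

  record GadgetAt (b t₁ t₂ E : ℕ) : Set where
    field
      saveAt  : CodeAt b saveCode (length saveCode + b)
      guessAt : CodeAt (length saveCode + b) guessCode (traceStart b)
      traceAt : CodeAt (traceStart b) (compileTrace (traceStart b) (failStart b) recorded) (successStart b)
      exit₁At : CodeAt (successStart b) (restoreCode ++ jump t₁ ∷ []) (failStart b)
      exit₂At : CodeAt (failStart b) (restoreCode ++ jump t₂ ∷ []) E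

  length-exit : ∀ t p → length (restoreCode ++ jump t ∷ []) + p ≡ suc (length restoreCode + p)
  length-exit t p = trans (cong (_+ p) (ListP.length-++ restoreCode)) (trans (+-assoc (length restoreCode) 1 p) (+-suc (length restoreCode) p))

  gadgetAt : ∀ b t₁ t₂ {E} → CodeAt b (choiceGadget b t₁ t₂) E → GadgetAt b t₁ t₂ E
  gadgetAt b t₁ t₂ {E} at₀ = record
    { saveAt = proj₁ at₁ ; guessAt = proj₁ at₂
    ; traceAt = subst (CodeAt (traceStart b) compiled) length-compiled (proj₁ at₃)
    ; exit₁At = subst (CodeAt (successStart b) _) (length-exit t₁ (successStart b)) (proj₁ at₄)
    ; exit₂At = subst (λ p → CodeAt p (restoreCode ++ jump t₂ ∷ []) E) (length-exit t₁ (successStart b)) (proj₂ at₄) }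
    where
      compiled = compileTrace (traceStart b) (failStart b) recorded
      exits = (restoreCode ++ jump t₁ ∷ []) ++ (restoreCode ++ jump t₂ ∷ [])
      length-compiled : length compiled + traceStart b ≡ successStart b
      length-compiled = cong (_+ traceStart b) (length-compileTrace (traceStart b) (failStart b) recorded)
      at₁ = CodeAt-++ saveCode at₀
      at₂ = CodeAt-++ guessCode (proj₂ at₁)
      at₃ = CodeAt-++ compiled (proj₂ at₂)
      at₄ = CodeAt-++ (restoreCode ++ jump t₁ ∷ []) (subst (λ p → CodeAt p exits E) length-compiled (proj₂ at₃))

  fresh-≢ : ∀ {i j : Fin 4} → i ≢ j → suc k ↑ʳ i ≢ suc k ↑ʳ j
  fresh-≢ i≢j e = i≢j (FinP.↑ʳ-injective (suc k) _ _ e)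

  ⇑≢fresh : ∀ a (i : Fin 4) → ⇑ a ≢ suc k ↑ʳ i
  ⇑≢fresh a i e = <⇒≢ (<-≤-trans (FinP.toℕ<n a) (m≤m+n (suc k) (toℕ i))) (begin
    toℕ a               ≡⟨ sym (FinP.toℕ-↑ˡ a 4) ⟩
    toℕ (⇑ a)           ≡⟨ cong toℕ e ⟩
    toℕ (suc k ↑ʳ i)    ≡⟨ FinP.toℕ-↑ʳ (suc k) i ⟩
    suc k + toℕ i       ∎)
    where open ≡-Reasoning

  jSave≢jRestore : jSave ≢ jRestore
  jSave≢jRestore = fresh-≢ λ ()
  jSave≢jFill : jSave ≢ jFill
  jSave≢jFill = fresh-≢ λ ()
  jSave≢jLow : jSave ≢ jLow
  jSave≢jLow = fresh-≢ λ ()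
  jRestore≢jFill : jRestore ≢ jFill
  jRestore≢jFill = fresh-≢ λ ()
  jRestore≢jLow : jRestore ≢ jLow
  jRestore≢jLow = fresh-≢ λ ()
  jFill≢jLow : jFill ≢ jLow
  jFill≢jLow = fresh-≢ λ ()

  opaque
    unfolding saveCode restoreCode
    runZ-saveCode : ∀ Z I → runZ saveCode Z I ≡ runZ (copyBlock jSave jLow K) Z (updI A I jLow 0)
    runZ-saveCode Z I = refl
    runI-saveCode : ∀ Z I → runI saveCode Z I ≡ runI (copyBlock jSave jLow K) Z (updI A I jLow 0)
    runI-saveCode Z I = refl
    runZ-restoreCode : ∀ Z I → runZ restoreCode Z I ≡ runZ (copyBlock jLow jRestore K ++ fillBlock jFill jSave K) Z (updI A I jLow 0)
    runZ-restoreCode Z I = refl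
    runI-restoreCode : ∀ Z I → runI restoreCode Z I ≡ runI (copyBlock jLow jRestore K ++ fillBlock jFill jSave K) Z (updI A I jLow 0)
    runI-restoreCode Z I = refl
    saveCode-straight : All Straight saveCode
    saveCode-straight = oneS ∷ copyBlock-straight jSave jLow K
    restoreCode-straight : All Straight restoreCode
    restoreCode-straight = oneS ∷ ++⁺ (copyBlock-straight jLow jRestore K) (fillBlock-straight jFill jSave K)

  record Simulates (Z′ : ℕ → U) (I′ : Fin (suc k′) → ℕ) (Z : ℕ → U) (I : Fin (suc k) → ℕ) : Set where
    field
      reg≡     : ∀ j → Z′ j ≡ Z j
      idx≡     : ∀ a → I′ (⇑ a) ≡ I a
      frontier : ℕ
      far      : U
      save≡    : I′ jSave ≡ frontier
      restore≡ : I′ jRestore ≡ frontier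
      fill≡    : I′ jFill ≡ frontier
      idx<     : ∀ a → I a < frontier
      K≤       : K ≤ frontier
      written< : maxWritten < frontier
      beyond   : ∀ j → frontier ≤ j → Z j ≡ far

  data _∼_ : Cfg → Config A L k → Set where
    sim : ∀ {ℓ Z′ I′ Z I} → Simulates Z′ I′ Z I → ⟨ label (start ℓ) , Z′ , I′ ⟩ ∼ ⟨ ℓ , Z , I ⟩

  module ChoiceGadget {Z′ I′ Z I} (R : Simulates Z′ I′ Z I) where
    open Simulates R renaming (frontier to G; far to w)

    savedZ : ℕ → U
    savedZ = runZ saveCode Z′ I′

    savedI : Fin (suc k′) → ℕ
    savedI = runI saveCode Z′ I′

    module Saved = CopiedBlock
      (subst₂ (CopiedBlock K jSave jLow Z′ (updI A I′ jLow 0) G 0) (sym (runZ-saveCode Z′ I′)) (sym (runI-saveCode Z′ I′))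
        (copyBlock-spec K jSave jLow jSave≢jLow Z′ (updI A I′ jLow 0) G 0
          (trans (updI-other I′ jLow 0 jSave (≢-sym jSave≢jLow)) save≡) (updI-same I′ jLow 0) (inj₁ K≤)))

    savedI-other : ∀ c → c ≢ jSave → c ≢ jLow → savedI c ≡ I′ c
    savedI-other c c≢jSave c≢jLow = trans (Saved.other c c≢jSave c≢jLow) (updI-other I′ jLow 0 c (≢-sym c≢jLow))

    seededZ : U → ℕ → U
    seededZ y = updZ A (updZ A savedZ 0 c₁) 0 y

    guessedZ : U → ℕ → U
    guessedZ y = runZ (spread maxReg) (seededZ y) savedI

    guessed-low : ∀ y j → j < K → guessedZ y j ≡ inputReg A (y ∷ []) j
    guessed-low y j j<K = trans (proj₁ (spread-spec maxReg (seededZ y) savedI) j (≤-pred j<K))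
                                (trans (updZ-same (updZ A savedZ 0 c₁) 0 y) (sym (inputReg-singleton y j)))

    guessed-high : ∀ y → AgreeFrom K (guessedZ y) savedZ
    guessed-high y j K≤j = begin
      guessedZ y j                                ≡⟨ proj₁ (proj₂ (spread-spec maxReg (seededZ y) savedI)) j K≤j ⟩
      updZ A (updZ A savedZ 0 c₁) 0 y j           ≡⟨ updZ-other (updZ A savedZ 0 c₁) 0 y j 0≢j ⟩
      updZ A savedZ 0 c₁ j                        ≡⟨ updZ-other savedZ 0 c₁ j 0≢j ⟩
      savedZ j                                    ∎
      where
        open ≡-Reasoning
        0≢j : 0 ≢ j
        0≢j = <⇒≢ (≤-trans (s≤s z≤n) K≤j)

    guessed-idx : ∀ y → runI (spread maxReg) (seededZ y) savedI ≡ savedI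
    guessed-idx y = proj₂ (proj₂ (spread-spec maxReg (seededZ y) savedI))

    restoredZ : (ℕ → U) → ℕ → U
    restoredZ Z₄ = runZ restoreCode Z₄ savedI

    restoredI : (ℕ → U) → Fin (suc k′) → ℕ
    restoredI Z₄ = runI restoreCode Z₄ savedI

    module Restored (Z₄ : ℕ → U) (Z₄≈saved : AgreeFrom K Z₄ savedZ) where
      I₅ = updI A savedI jLow 0
      copiedZ = runZ (copyBlock jLow jRestore K) Z₄ I₅
      copiedI = runI (copyBlock jLow jRestore K) Z₄ I₅

      module Copied = CopiedBlock
        (copyBlock-spec K jLow jRestore (≢-sym jRestore≢jLow) Z₄ I₅ 0 G (updI-same savedI jLow 0)
          (trans (updI-other savedI jLow 0 jRestore (≢-sym jRestore≢jLow))
                 (trans (savedI-other jRestore (≢-sym jSave≢jRestore) jRestore≢jLow) restore≡)) (inj₂ K≤))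

      copiedI-other : ∀ c → c ≢ jLow → c ≢ jRestore → copiedI c ≡ savedI c
      copiedI-other c c≢jLow c≢jRestore = trans (Copied.other c c≢jLow c≢jRestore) (updI-other savedI jLow 0 c (≢-sym c≢jLow))

      copiedI-jSave : copiedI jSave ≡ G + K
      copiedI-jSave = trans (copiedI-other jSave jSave≢jLow jSave≢jRestore) Saved.at-a

      module Filled = FilledBlock
        (fillBlock-spec K jFill jSave (≢-sym jSave≢jFill) copiedZ copiedI G (G + K)
          (trans (copiedI-other jFill jFill≢jLow (≢-sym jRestore≢jFill)) (trans (savedI-other jFill (≢-sym jSave≢jFill) jFill≢jLow) fill≡))
          copiedI-jSave (inj₂ ≤-refl))

      restoredZ≡ : ∀ j → restoredZ Z₄ j ≡ runZ (fillBlock jFill jSave K) copiedZ copiedI j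
      restoredZ≡ j = cong (λ X → X j) (trans (runZ-restoreCode Z₄ savedI) (runZ-++ (copyBlock jLow jRestore K) _ Z₄ I₅))

      restoredI≡ : ∀ a → restoredI Z₄ a ≡ runI (fillBlock jFill jSave K) copiedZ copiedI a
      restoredI≡ a = cong (λ X → X a) (trans (runI-restoreCode Z₄ savedI) (runI-++ (copyBlock jLow jRestore K) _ Z₄ I₅))

      restored-reg : ∀ j → restoredZ Z₄ j ≡ Z j
      restored-reg j with j <? K | j <? G | j <? G + K
      ... | yes j<K | _ | _ = begin
        restoredZ Z₄ j     ≡⟨ restoredZ≡ j ⟩
        _                  ≡⟨ Filled.kept j (inj₁ (<-≤-trans j<K K≤)) ⟩
        copiedZ j          ≡⟨ Copied.moved j j<K ⟩
        Z₄ (G + j)         ≡⟨ Z₄≈saved (G + j) (≤-trans K≤ (m≤m+n G j)) ⟩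
        savedZ (G + j)     ≡⟨ Saved.moved j j<K ⟩
        Z′ j               ≡⟨ reg≡ j ⟩
        Z j                ∎
        where open ≡-Reasoning
      ... | no j≮K | yes j<G | _ = begin
        restoredZ Z₄ j     ≡⟨ restoredZ≡ j ⟩
        _                  ≡⟨ Filled.kept j (inj₁ j<G) ⟩
        copiedZ j          ≡⟨ Copied.kept j (inj₂ (≮⇒≥ j≮K)) ⟩
        Z₄ j               ≡⟨ Z₄≈saved j (≮⇒≥ j≮K) ⟩
        savedZ j           ≡⟨ Saved.kept j (inj₁ j<G) ⟩
        Z′ j               ≡⟨ reg≡ j ⟩
        Z j                ∎
        where open ≡-Reasoning
      ... | no _ | no j≮G | yes j<G+K = begin
        restoredZ Z₄ j             ≡⟨ restoredZ≡ j ⟩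
        _                          ≡⟨ cong (runZ (fillBlock jFill jSave K) copiedZ copiedI) (sym G+u≡j) ⟩
        _                          ≡⟨ Filled.filled u u<K ⟩
        copiedZ (G + K)            ≡⟨ Copied.kept (G + K) (inj₂ (m≤n+m K G)) ⟩
        Z₄ (G + K)                 ≡⟨ Z₄≈saved (G + K) (m≤n+m K G) ⟩
        savedZ (G + K)             ≡⟨ Saved.kept (G + K) (inj₂ ≤-refl) ⟩
        Z′ (G + K)                 ≡⟨ reg≡ (G + K) ⟩
        Z (G + K)                  ≡⟨ beyond (G + K) (m≤m+n G K) ⟩
        w                          ≡⟨ sym (beyond j (≮⇒≥ j≮G)) ⟩
        Z j                        ∎
        where
          open ≡-Reasoning
          u = j ∸ G
          G+u≡j : G + u ≡ j
          G+u≡j = m+[n∸m]≡n (≮⇒≥ j≮G)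
          u<K : u < K
          u<K = +-cancelˡ-< G u K (subst (_< G + K) (sym G+u≡j) j<G+K)
      ... | no _ | no _ | no j≮G+K = begin
        restoredZ Z₄ j     ≡⟨ restoredZ≡ j ⟩
        _                  ≡⟨ Filled.kept j (inj₂ (≮⇒≥ j≮G+K)) ⟩
        copiedZ j          ≡⟨ Copied.kept j (inj₂ K≤j) ⟩
        Z₄ j               ≡⟨ Z₄≈saved j K≤j ⟩
        savedZ j           ≡⟨ Saved.kept j (inj₂ (≮⇒≥ j≮G+K)) ⟩
        Z′ j               ≡⟨ reg≡ j ⟩
        Z j                ∎
        where
          open ≡-Reasoning
          K≤j : K ≤ j
          K≤j = ≤-trans (m≤n+m K G) (≮⇒≥ j≮G+K)

      restored-idx : ∀ a → restoredI Z₄ (⇑ a) ≡ I a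
      restored-idx a = begin
        restoredI Z₄ (⇑ a)   ≡⟨ restoredI≡ (⇑ a) ⟩
        _                    ≡⟨ Filled.other (⇑ a) (⇑≢fresh a _) ⟩
        copiedI (⇑ a)        ≡⟨ copiedI-other (⇑ a) (⇑≢fresh a _) (⇑≢fresh a _) ⟩
        savedI (⇑ a)         ≡⟨ savedI-other (⇑ a) (⇑≢fresh a _) (⇑≢fresh a _) ⟩
        I′ (⇑ a)             ≡⟨ idx≡ a ⟩
        I a                  ∎
        where open ≡-Reasoning

      restored : Simulates (restoredZ Z₄) (restoredI Z₄) Z I
      restored = record
        { reg≡ = restored-reg ; idx≡ = restored-idx ; frontier = G + K ; far = w
        ; save≡ = trans (restoredI≡ jSave) (trans (Filled.other jSave jSave≢jFill) copiedI-jSave)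
        ; restore≡ = trans (restoredI≡ jRestore) (trans (Filled.other jRestore jRestore≢jFill) Copied.at-b)
        ; fill≡ = trans (restoredI≡ jFill) Filled.at-a
        ; idx< = λ a → ≤-trans (idx< a) (m≤m+n G K)
        ; K≤ = ≤-trans K≤ (m≤m+n G K)
        ; written< = ≤-trans written< (m≤m+n G K)
        ; beyond = λ j G+K≤j → beyond j (≤-trans (m≤m+n G K) G+K≤j) }

    module Runs (b : ℕ) (l₁ l₂ : Fin (suc L)) {E : ℕ} (at : GadgetAt b (start l₁) (start l₂) E) where
      open GadgetAt at
      open Replay k′ N code Q K (failStart b)

      save-run : Star (Move Q) ⟨ label b , Z′ , I′ ⟩ ⟨ label (length saveCode + b) , savedZ , savedI ⟩
      save-run = run-straight Q Z′ I′ saveAt saveCode-straight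

      guess-run : ∀ y → y ≡ c₁ ⊎ y ≡ c₂ →
                  Star (Move Q) ⟨ label (length saveCode + b) , savedZ , savedI ⟩ ⟨ label (traceStart b) , guessedZ y , savedI ⟩
      guess-run y y∈ =
        straight-step Q savedZ savedI (CodeAt-< guessAt) (CodeAt-head guessAt) constS ◅
        nu-step Q (updZ A savedZ 0 c₁) savedI y (CodeAt-< (CodeAt-tail guessAt)) (CodeAt-head (CodeAt-tail guessAt))
          (updZ A savedZ 0 c₁ 0 , y , inj₁ (updZ-same savedZ 0 c₁) , y∈ , refl) ◅
        subst (λ I₃ → Star (Move Q) ⟨ label (suc (suc (length saveCode + b))) , seededZ y , savedI ⟩ ⟨ label (traceStart b) , guessedZ y , I₃ ⟩)
              (guessed-idx y)
          (run-straight Q (seededZ y) savedI (CodeAt-tail (CodeAt-tail guessAt)) (spread-straight maxReg))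

      exit-run : ∀ {p t e} Z₄ → CodeAt p (restoreCode ++ jump t ∷ []) e →
                 Star (Move Q) ⟨ label p , Z₄ , savedI ⟩ ⟨ label t , restoredZ Z₄ , restoredI Z₄ ⟩
      exit-run Z₄ exitAt = run-straight-goto Q jSave restoreCode Z₄ savedI exitAt restoreCode-straight

      recordedHalts : Stopped A P (proj₁ P-halts-on-c₁)
      recordedHalts = proj₂ (proj₂ P-halts-on-c₁)

      choose₁ : Σ Cfg λ d′ → Star (Move Q) ⟨ label b , Z′ , I′ ⟩ d′ × d′ ∼ ⟨ l₁ , Z , I ⟩
      choose₁ = follow (replay P recordedRun recordedHalts (inputReg A (c₁ ∷ [])) (guessedZ c₁) savedI traceAt recorded-below (guessed-low c₁))
        where
          follow : ReplayOutcome P (traceStart b) (successStart b) (guessedZ c₁) savedI (initial A P (0 , c₁ ∷ [])) (inputReg A (c₁ ∷ [])) →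
                   Σ Cfg λ d′ → Star (Move Q) ⟨ label b , Z′ , I′ ⟩ d′ × d′ ∼ ⟨ l₁ , Z , I ⟩
          follow (inj₂ (_ , disagrees)) = ⊥-elim (disagrees (λ _ _ → refl))
          follow (inj₁ ((Z₄ , Z₄≈ , replayed) , _)) =
            _ , save-run ◅◅ guess-run c₁ (inj₁ refl) ◅◅ replayed ◅◅ exit-run Z₄ exit₁At ,
            sim (Restored.restored Z₄ (AgreeFrom-trans Z₄≈ (guessed-high c₁)))

      -- P diverges on c₂, so the replay on c₂ cannot follow the recorded run to its end.
      choose₂ : Σ Cfg λ d′ → Star (Move Q) ⟨ label b , Z′ , I′ ⟩ d′ × d′ ∼ ⟨ l₂ , Z , I ⟩
      choose₂ = deviate (replay P recordedRun recordedHalts (inputReg A (c₂ ∷ [])) (guessedZ c₂) savedI traceAt recorded-below (guessed-low c₂))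
        where
          deviate : ReplayOutcome P (traceStart b) (successStart b) (guessedZ c₂) savedI (initial A P (0 , c₂ ∷ [])) (inputReg A (c₁ ∷ [])) →
                    Σ Cfg λ d′ → Star (Move Q) ⟨ label b , Z′ , I′ ⟩ d′ × d′ ∼ ⟨ l₂ , Z , I ⟩
          deviate (inj₁ (_ , halts)) = ⊥-elim (P-diverges-on-c₂ halts)
          deviate (inj₂ ((Z₄ , Z₄≈ , replayed) , _)) =
            _ , save-run ◅◅ guess-run c₂ (inj₂ refl) ◅◅ replayed ◅◅ exit-run Z₄ exit₂At ,
            sim (Restored.restored Z₄ (AgreeFrom-trans Z₄≈ (guessed-high c₂)))

      guess-steps⁻¹ : ∀ {n f} → Steps (Move Q) n ⟨ label (length saveCode + b) , savedZ , savedI ⟩ f → Halted Q f →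
                      Σ U λ y → Σ ℕ λ m → m ≤ n × Steps (Move Q) m ⟨ label (traceStart b) , guessedZ y , savedI ⟩ f
      guess-steps⁻¹ {f = f} ss stop =
        let m₁ , m₁<n , ss₁ = straight-steps⁻¹ Q (CodeAt-< guessAt) (CodeAt-head guessAt) constS ss stop
            y , _ , m₂ , m₂<m₁ , ss₂ = nu-steps⁻¹ Q (CodeAt-< (CodeAt-tail guessAt)) (CodeAt-head (CodeAt-tail guessAt)) ss₁ stop
            m₃ , m₃≤m₂ , ss₃ = run-straight⁻¹ Q (seededZ y) savedI (CodeAt-tail (CodeAt-tail guessAt)) (spread-straight maxReg) ss₂ stop
        in y , m₃ , ≤-trans m₃≤m₂ (≤-trans (<⇒≤ m₂<m₁) (<⇒≤ m₁<n)) ,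
           subst (λ I₃ → Steps (Move Q) m₃ ⟨ label (traceStart b) , guessedZ y , I₃ ⟩ f) (guessed-idx y) ss₃

      exit-steps⁻¹ : ∀ {p t e n f} Z₄ → CodeAt p (restoreCode ++ jump t ∷ []) e →
                     Steps (Move Q) n ⟨ label p , Z₄ , savedI ⟩ f → Halted Q f →
                     Σ ℕ λ m → m < n × Steps (Move Q) m ⟨ label t , restoredZ Z₄ , restoredI Z₄ ⟩ f
      exit-steps⁻¹ Z₄ exitAt ss stop = run-straight-goto⁻¹ Q jSave restoreCode Z₄ savedI exitAt restoreCode-straight ss stop

      gadget-steps⁻¹ : ∀ {n f} → Steps (Move Q) n ⟨ label b , Z′ , I′ ⟩ f → Halted Q f →
                       Σ (ℕ → U) λ Z₄ → AgreeFrom K Z₄ savedZ × Σ ℕ λ m → m < n ×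
                         (Steps (Move Q) m ⟨ label (start l₁) , restoredZ Z₄ , restoredI Z₄ ⟩ f
                          ⊎ Steps (Move Q) m ⟨ label (start l₂) , restoredZ Z₄ , restoredI Z₄ ⟩ f)
      gadget-steps⁻¹ {n} {f} ss stop =
        let m₁ , m₁≤n , ss₁ = run-straight⁻¹ Q Z′ I′ saveAt saveCode-straight ss stop
            y , m₂ , m₂≤m₁ , ss₂ = guess-steps⁻¹ ss₁ stop
            Z₄ , Z₄≈ , m₃ , m₃≤m₂ , exit = replay⁻¹ recorded (guessedZ y) savedI traceAt recorded-below ss₂ stop
        in Z₄ , AgreeFrom-trans Z₄≈ (guessed-high y) , leave Z₄ (≤-trans m₃≤m₂ (≤-trans m₂≤m₁ m₁≤n)) exit
        where
          leave : ∀ {m₃} Z₄ → m₃ ≤ n →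
                  Steps (Move Q) m₃ ⟨ label (successStart b) , Z₄ , savedI ⟩ f ⊎ Steps (Move Q) m₃ ⟨ label (failStart b) , Z₄ , savedI ⟩ f →
                  Σ ℕ λ m → m < n × (Steps (Move Q) m ⟨ label (start l₁) , restoredZ Z₄ , restoredI Z₄ ⟩ f
                                     ⊎ Steps (Move Q) m ⟨ label (start l₂) , restoredZ Z₄ , restoredI Z₄ ⟩ f)
          leave Z₄ m₃≤n (inj₁ ss₃) = let m , m<m₃ , ss₄ = exit-steps⁻¹ Z₄ exit₁At ss₃ stop in m , <-≤-trans m<m₃ m₃≤n , inj₁ ss₄
          leave Z₄ m₃≤n (inj₂ ss₃) = let m , m<m₃ , ss₄ = exit-steps⁻¹ Z₄ exit₂At ss₃ stop in m , <-≤-trans m<m₃ m₃≤n , inj₂ ss₄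

  5≤B : 5 ≤ B
  5≤B = +-mono-≤ 4≤length-saveCode (s≤s z≤n)

  length-choiceGadget : ∀ b t₁ t₂ → length (choiceGadget b t₁ t₂) ≡ B
  length-choiceGadget b t₁ t₂ =
    trans (ListP.length-++ saveCode) (cong (length saveCode +_)
      (trans (ListP.length-++ guessCode) (cong (length guessCode +_)
        (trans (ListP.length-++ (compileTrace (traceStart b) (failStart b) recorded))
          (cong₂ _+_ (length-compileTrace (traceStart b) (failStart b) recorded)
            (trans (ListP.length-++ (restoreCode ++ jump t₁ ∷ []))
              (cong₂ _+_ (ListP.length-++ restoreCode) (ListP.length-++ restoreCode))))))))

  length-compileAt : ∀ ℓ X → length (compileAt ℓ X) ≤ B
  length-compileAt ℓ (opI i j as) = ≤-trans (s≤s (s≤s z≤n)) 5≤B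
  length-compileAt ℓ (constI j c) = ≤-trans (s≤s (s≤s z≤n)) 5≤B
  length-compileAt ℓ (copyI j j′) = ≤-trans (s≤s (s≤s z≤n)) 5≤B
  length-compileAt ℓ (indCopyI a b) = ≤-trans (s≤s (s≤s z≤n)) 5≤B
  length-compileAt ℓ (setOneI a) = ≤-trans (s≤s (s≤s z≤n)) 5≤B
  length-compileAt ℓ (incI a) = 5≤B
  length-compileAt ℓ (relBrI i as ℓ₁ ℓ₂) = ≤-trans (s≤s z≤n) 5≤B
  length-compileAt ℓ (idxBrI a b ℓ₁ ℓ₂) = ≤-trans (s≤s z≤n) 5≤B
  length-compileAt ℓ stopI = ≤-trans (s≤s z≤n) 5≤B
  length-compileAt ℓ (choiceI _ ℓ₁ ℓ₂) = ≤-reflexive (length-choiceGadget (start ℓ) (start ℓ₁) (start ℓ₂))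
  length-compileAt ℓ (nuI _ j as) = ≤-trans (s≤s z≤n) 5≤B

  blockAt : ∀ ℓ {X} → Program.body M ℓ ≡ X → CodeAt (start ℓ) (compileAt ℓ X) (length (compileAt ℓ X) + start ℓ)
  blockAt ℓ {X} eq = subst (λ Y → CodeAt (start ℓ) (compileAt ℓ Y) (length (compileAt ℓ Y) + start ℓ)) eq
                           (CodeAt-block ℓ (length-compileAt ℓ (Program.body M ℓ)))

  bump : (Fin (suc k′) → ℕ) → Fin (suc k′) → ℕ
  bump I = let I₁ = updI A I jSave (suc (I jSave))
               I₂ = updI A I₁ jRestore (suc (I₁ jRestore))
           in updI A I₂ jFill (suc (I₂ jFill))

  module _ (I : Fin (suc k′) → ℕ) where
    private
      I₁ = updI A I jSave (suc (I jSave))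
      I₂ = updI A I₁ jRestore (suc (I₁ jRestore))

    bump-jSave : bump I jSave ≡ suc (I jSave)
    bump-jSave = trans (updI-other I₂ jFill _ jSave (≢-sym jSave≢jFill))
                       (trans (updI-other I₁ jRestore _ jSave (≢-sym jSave≢jRestore)) (updI-same I jSave _))

    bump-jRestore : bump I jRestore ≡ suc (I jRestore)
    bump-jRestore = trans (updI-other I₂ jFill _ jRestore (≢-sym jRestore≢jFill))
                          (trans (updI-same I₁ jRestore _) (cong suc (updI-other I jSave _ jRestore jSave≢jRestore)))

    bump-jFill : bump I jFill ≡ suc (I jFill)
    bump-jFill = trans (updI-same I₂ jFill _)
                       (cong suc (trans (updI-other I₁ jRestore _ jFill jRestore≢jFill) (updI-other I jSave _ jFill jSave≢jFill)))

    bump-⇑ : ∀ a → bump I (⇑ a) ≡ I (⇑ a)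
    bump-⇑ a = trans (updI-other I₂ jFill _ (⇑ a) (≢-sym (⇑≢fresh a _)))
                 (trans (updI-other I₁ jRestore _ (⇑ a) (≢-sym (⇑≢fresh a _))) (updI-other I jSave _ (⇑ a) (≢-sym (⇑≢fresh a _))))

  module Preservation {Z′ I′ Z I} (R : Simulates Z′ I′ Z I) (ℓ : Fin (suc L)) where
    open Simulates R renaming (frontier to G; far to w)

    write : ∀ {j′ j v′ v} → j′ ≡ j → v′ ≡ v → j < G → Simulates (updZ A Z′ j′ v′) I′ (updZ A Z j v) I
    write {j = j} {v = v} refl refl j<G = record
      { reg≡ = updZ-cong j reg≡ refl ; idx≡ = idx≡ ; frontier = G ; far = w ; save≡ = save≡ ; restore≡ = restore≡
      ; fill≡ = fill≡ ; idx< = idx< ; K≤ = K≤ ; written< = written<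
      ; beyond = λ m G≤m → trans (updZ-other Z j v m (<⇒≢ (<-≤-trans j<G G≤m))) (beyond m G≤m) }

    written<G : ∀ X → Program.body M ℓ ≡ X → writtenReg X < G
    written<G X eq = ≤-<-trans (subst (λ Y → writtenReg Y ≤ maxWritten) eq (writtenReg≤maxWritten ℓ)) written<

    updI-⇑ : ∀ a v b → updI A I′ (⇑ a) v (⇑ b) ≡ updI A I a v b
    updI-⇑ a v b = by-cases (a ≟ᶠ b)
      where
        by-cases : Dec (a ≡ b) → updI A I′ (⇑ a) v (⇑ b) ≡ updI A I a v b
        by-cases (yes refl) = trans (updI-same I′ (⇑ a) v) (sym (updI-same I a v))
        by-cases (no a≢b) = trans (updI-other I′ (⇑ a) v (⇑ b) (λ e → a≢b (FinP.↑ˡ-injective 4 a b e)))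
                                  (trans (idx≡ b) (sym (updI-other I a v b a≢b)))

    updI-< : ∀ {a v H} → v < H → (∀ b → I b < H) → ∀ b → updI A I a v b < H
    updI-< {a} {v} {H} v<H I<H b = by-cases (a ≟ᶠ b)
      where
        by-cases : Dec (a ≡ b) → updI A I a v b < H
        by-cases (yes refl) = subst (_< H) (sym (updI-same I a v)) v<H
        by-cases (no a≢b) = subst (_< H) (sym (updI-other I a v b a≢b)) (I<H b)

    setOne : ∀ a → Simulates Z′ (updI A I′ (⇑ a) 0) Z (updI A I a 0)
    setOne a = record
      { reg≡ = reg≡ ; idx≡ = updI-⇑ a 0 ; frontier = G ; far = w ; K≤ = K≤ ; written< = written< ; beyond = beyond
      ; save≡ = trans (updI-other I′ (⇑ a) 0 jSave (⇑≢fresh a _)) save≡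
      ; restore≡ = trans (updI-other I′ (⇑ a) 0 jRestore (⇑≢fresh a _)) restore≡
      ; fill≡ = trans (updI-other I′ (⇑ a) 0 jFill (⇑≢fresh a _)) fill≡
      ; idx< = updI-< {a} (≤-<-trans z≤n written<) idx< }

    -- Incrementing an index register of M also advances the frontier, keeping it above all indices.
    increment : ∀ a → Simulates Z′ (runI (incrementCode a) Z′ I′) Z (updI A I a (suc (I a)))
    increment a = record
      { reg≡ = reg≡
      ; idx≡ = λ b → trans (bump-⇑ I₁ b) (trans (cong (λ v → updI A I′ (⇑ a) v (⇑ b)) (cong suc (idx≡ a))) (updI-⇑ a _ b))
      ; frontier = suc G ; far = w
      ; save≡ = trans (bump-jSave I₁) (cong suc (trans (updI-other I′ (⇑ a) _ jSave (⇑≢fresh a _)) save≡))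
      ; restore≡ = trans (bump-jRestore I₁) (cong suc (trans (updI-other I′ (⇑ a) _ jRestore (⇑≢fresh a _)) restore≡))
      ; fill≡ = trans (bump-jFill I₁) (cong suc (trans (updI-other I′ (⇑ a) _ jFill (⇑≢fresh a _)) fill≡))
      ; idx< = updI-< {a} (s≤s (idx< a)) (λ b → ≤-trans (idx< b) (n≤1+n G))
      ; K≤ = ≤-trans K≤ (n≤1+n G) ; written< = ≤-trans written< (n≤1+n G)
      ; beyond = λ j 1+G≤j → beyond j (≤-trans (n≤1+n G) 1+G≤j) }
      where
        I₁ = updI A I′ (⇑ a) (suc (I′ (⇑ a)))

  StepM : Config A L k → Config A L k → Set
  StepM = Step A M (NoOracle A)

  module Forward {ℓ : Fin (suc L)} {Z′ I′ Z I} (R : Simulates Z′ I′ Z I) where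
    open Simulates R
    open Preservation R ℓ

    straight-block : ∀ {ℓ₂ e} xs → toℕ ℓ₂ ≡ suc (toℕ ℓ) → CodeAt (start ℓ) (xs ++ jump (next ℓ) ∷ []) e → All Straight xs →
                     Star (Move Q) ⟨ label (start ℓ) , Z′ , I′ ⟩ ⟨ label (start ℓ₂) , runZ xs Z′ I′ , runI xs Z′ I′ ⟩
    straight-block xs ℓ₂≡ at sxs =
      subst (λ n → Star (Move Q) ⟨ label (start ℓ) , Z′ , I′ ⟩ ⟨ label (base + n * B) , runZ xs Z′ I′ , runI xs Z′ I′ ⟩) (sym ℓ₂≡)
            (run-straight-goto Q jSave xs Z′ I′ at sxs)

    step : ∀ {d} → StepM ⟨ ℓ , Z , I ⟩ d → Σ Cfg λ d′ → Star (Move Q) ⟨ label (start ℓ) , Z′ , I′ ⟩ d′ × d′ ∼ d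
    step (s-op {ℓ' = ℓ₂} {i = i} {j = j} {as = as} eq p) =
      _ , straight-block (pOp i j as ∷ []) p (blockAt ℓ eq) (opS ∷ []) ,
      sim (write refl (cong (op i) (VecP.map-cong reg≡ as)) (written<G _ eq))
    step (s-const {ℓ' = ℓ₂} {j = j} {i = c} eq p) =
      _ , straight-block (pConst j c ∷ []) p (blockAt ℓ eq) (constS ∷ []) , sim (write refl refl (written<G _ eq))
    step (s-copy {ℓ' = ℓ₂} {j = j} {j' = j′} eq p) =
      _ , straight-block (pCopy j j′ ∷ []) p (blockAt ℓ eq) (copyS ∷ []) , sim (write refl (reg≡ j′) (written<G _ eq))
    step (s-icopy {ℓ' = ℓ₂} {a = a} {b = b} eq p) =
      _ , straight-block (pICopy (⇑ a) (⇑ b) ∷ []) p (blockAt ℓ eq) (icopyS ∷ []) ,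
      sim (write (idx≡ a) (trans (reg≡ _) (cong Z (idx≡ b))) (idx< a))
    step (s-one {ℓ' = ℓ₂} {a = a} eq p) =
      _ , straight-block (pOne (⇑ a) ∷ []) p (blockAt ℓ eq) (oneS ∷ []) , sim (setOne a)
    step (s-inc {ℓ' = ℓ₂} {a = a} eq p) =
      _ , straight-block (incrementCode a) p (blockAt ℓ eq) (incS ∷ incS ∷ incS ∷ incS ∷ []) , sim (increment a)
    step (s-relT {i = i} {as = as} {ℓ₁ = ℓ₁} eq r) =
      _ , rel-true-step Q Z′ I′ (CodeAt-< (blockAt ℓ eq)) (CodeAt-head (blockAt ℓ eq)) (trans (cong (rel i) (VecP.map-cong reg≡ as)) r) ◅ ε ,
      sim R
    step (s-relF {i = i} {as = as} {ℓ₂ = ℓ₂} eq r) =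
      _ , rel-false-step Q Z′ I′ (CodeAt-< (blockAt ℓ eq)) (CodeAt-head (blockAt ℓ eq)) (trans (cong (rel i) (VecP.map-cong reg≡ as)) r) ◅ ε ,
      sim R
    step (s-idxT {a = a} {b = b} {ℓ₁ = ℓ₁} eq e) =
      _ , idx-true-step Q Z′ I′ (CodeAt-< (blockAt ℓ eq)) (CodeAt-head (blockAt ℓ eq)) (trans (idx≡ a) (trans e (sym (idx≡ b)))) ◅ ε ,
      sim R
    step (s-idxF {a = a} {b = b} {ℓ₂ = ℓ₂} eq e) =
      _ , idx-false-step Q Z′ I′ (CodeAt-< (blockAt ℓ eq)) (CodeAt-head (blockAt ℓ eq)) (λ e′ → e (trans (sym (idx≡ a)) (trans e′ (idx≡ b)))) ◅ ε ,
      sim R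
    step (s-ch₁ {ℓ₁ = ℓ₁} {ℓ₂ = ℓ₂} eq) = ChoiceGadget.Runs.choose₁ R (start ℓ) ℓ₁ ℓ₂ (gadgetAt _ _ _ (blockAt ℓ eq))
    step (s-ch₂ {ℓ₁ = ℓ₁} {ℓ₂ = ℓ₂} eq) = ChoiceGadget.Runs.choose₂ R (start ℓ) ℓ₁ ℓ₂ (gadgetAt _ _ _ (blockAt ℓ eq))
    step (s-nu {e = ()} _ _ _ _)

  simulate-step : ∀ {c′ c d} → c′ ∼ c → StepM c d → Σ Cfg λ d′ → Star (Move Q) c′ d′ × d′ ∼ d
  simulate-step (sim R) s = Forward.step R s

  simulate-run : ∀ {c′ c d} → c′ ∼ c → Star StepM c d → Σ Cfg λ d′ → Star (Move Q) c′ d′ × d′ ∼ d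
  simulate-run c′∼c ε = _ , ε , c′∼c
  simulate-run c′∼c (s ◅ ss) =
    let d′ , run₁ , d′∼d = simulate-step c′∼c s
        e′ , run₂ , e′∼e = simulate-run d′∼d ss
    in e′ , run₁ ◅◅ run₂ , e′∼e

  simulates-output : ∀ {c′ c} → c′ ∼ c → output A c′ ≡ output A c
  simulates-output (sim {Z′ = Z′} {I′} {Z} {I} R) with I′ Fin.zero | Simulates.idx≡ R Fin.zero
  ... | _ | refl = cong (I Fin.zero ,_) (VecP.tabulate-cong (λ i → Simulates.reg≡ R (toℕ i)))

  simulates-halted : ∀ {c′ c} → c′ ∼ c → Stopped A M c → Halted Q c′
  simulates-halted (sim {ℓ = ℓ} {Z′} {I′} R) stop = stop-halted Q {Z = Z′} {I = I′} (CodeAt-< (blockAt ℓ stop)) (CodeAt-head (blockAt ℓ stop))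

  BackStep : Cfg → Config A L k → ℕ → Cfg → Set
  BackStep c′ c n f = (Stopped A M c × f ≡ c′)
                    ⊎ (Σ (Config A L k) λ d → StepM c d × Σ Cfg λ d′ → d′ ∼ d × Σ ℕ λ m → m < n × Steps (Move Q) m d′ f)

  module Backward {ℓ : Fin (suc L)} {Z′ I′ Z I} (R : Simulates Z′ I′ Z I) where
    open Simulates R
    open Preservation R ℓ

    From : Cfg
    From = ⟨ label (start ℓ) , Z′ , I′ ⟩

    advance : ∀ {X e n f} xs → Program.body M ℓ ≡ X → X ≢ stopI → CodeAt (start ℓ) (xs ++ jump (next ℓ) ∷ []) e → All Straight xs →
              (∀ {ℓ₂} → toℕ ℓ₂ ≡ suc (toℕ ℓ) → Σ (Config A L k) λ d → StepM ⟨ ℓ , Z , I ⟩ d × ⟨ label (start ℓ₂) , runZ xs Z′ I′ , runI xs Z′ I′ ⟩ ∼ d) →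
              Steps (Move Q) n From f → Halted Q f → BackStep From ⟨ ℓ , Z , I ⟩ n f
    advance {f = f} xs eq not-stop at sxs step ss stop =
      let ℓ₂ , ℓ₂≡ = successor-label M ℓ (λ e → not-stop (trans (sym eq) e))
          m , m<n , rest = run-straight-goto⁻¹ Q jSave xs Z′ I′ at sxs ss stop
          d , s , d′∼d = step ℓ₂≡
      in inj₂ (d , s , _ , d′∼d , m , m<n ,
               subst (λ t → Steps (Move Q) m ⟨ label (base + t * B) , runZ xs Z′ I′ , runI xs Z′ I′ ⟩ f) (sym ℓ₂≡) rest)

    step⁻¹ : ∀ X → Program.body M ℓ ≡ X → ∀ {n f} → Steps (Move Q) n From f → Halted Q f → BackStep From ⟨ ℓ , Z , I ⟩ n f
    step⁻¹ (opI i j as) eq = advance (pOp i j as ∷ []) eq (λ ()) (blockAt ℓ eq) (opS ∷ [])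
      λ ℓ₂≡ → _ , s-op eq ℓ₂≡ , sim (write refl (cong (op i) (VecP.map-cong reg≡ as)) (written<G _ eq))
    step⁻¹ (constI j c) eq = advance (pConst j c ∷ []) eq (λ ()) (blockAt ℓ eq) (constS ∷ [])
      λ ℓ₂≡ → _ , s-const eq ℓ₂≡ , sim (write refl refl (written<G _ eq))
    step⁻¹ (copyI j j′) eq = advance (pCopy j j′ ∷ []) eq (λ ()) (blockAt ℓ eq) (copyS ∷ [])
      λ ℓ₂≡ → _ , s-copy eq ℓ₂≡ , sim (write refl (reg≡ j′) (written<G _ eq))
    step⁻¹ (indCopyI a b) eq = advance (pICopy (⇑ a) (⇑ b) ∷ []) eq (λ ()) (blockAt ℓ eq) (icopyS ∷ [])
      λ ℓ₂≡ → _ , s-icopy eq ℓ₂≡ , sim (write (idx≡ a) (trans (reg≡ _) (cong Z (idx≡ b))) (idx< a))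
    step⁻¹ (setOneI a) eq = advance (pOne (⇑ a) ∷ []) eq (λ ()) (blockAt ℓ eq) (oneS ∷ [])
      λ ℓ₂≡ → _ , s-one eq ℓ₂≡ , sim (setOne a)
    step⁻¹ (incI a) eq = advance (incrementCode a) eq (λ ()) (blockAt ℓ eq) (incS ∷ incS ∷ incS ∷ incS ∷ [])
      λ ℓ₂≡ → _ , s-inc eq ℓ₂≡ , sim (increment a)
    step⁻¹ (relBrI i as ℓ₁ ℓ₂) eq ss stop = branch (rel-steps⁻¹ Q (CodeAt-< (blockAt ℓ eq)) (CodeAt-head (blockAt ℓ eq)) ss stop)
      where
        rel≡ : rel i (Vec.map Z′ as) ≡ rel i (Vec.map Z as)
        rel≡ = cong (rel i) (VecP.map-cong reg≡ as)
        branch : ∀ {n f} → Σ ℕ (λ m → m < n × ((rel i (Vec.map Z′ as) ≡ true × Steps (Move Q) m ⟨ label (start ℓ₁) , Z′ , I′ ⟩ f)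
                                               ⊎ (rel i (Vec.map Z′ as) ≡ false × Steps (Move Q) m ⟨ label (start ℓ₂) , Z′ , I′ ⟩ f))) →
                 BackStep From ⟨ ℓ , Z , I ⟩ n f
        branch (m , m<n , inj₁ (r , rest)) = inj₂ (_ , s-relT eq (trans (sym rel≡) r) , _ , sim R , m , m<n , rest)
        branch (m , m<n , inj₂ (r , rest)) = inj₂ (_ , s-relF eq (trans (sym rel≡) r) , _ , sim R , m , m<n , rest)
    step⁻¹ (idxBrI a b ℓ₁ ℓ₂) eq ss stop = branch (idx-steps⁻¹ Q (CodeAt-< (blockAt ℓ eq)) (CodeAt-head (blockAt ℓ eq)) ss stop)
      where
        branch : ∀ {n f} → Σ ℕ (λ m → m < n × ((I′ (⇑ a) ≡ I′ (⇑ b) × Steps (Move Q) m ⟨ label (start ℓ₁) , Z′ , I′ ⟩ f)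
                                               ⊎ (I′ (⇑ a) ≢ I′ (⇑ b) × Steps (Move Q) m ⟨ label (start ℓ₂) , Z′ , I′ ⟩ f))) →
                 BackStep From ⟨ ℓ , Z , I ⟩ n f
        branch (m , m<n , inj₁ (e , rest)) =
          inj₂ (_ , s-idxT eq (trans (sym (idx≡ a)) (trans e (idx≡ b))) , _ , sim R , m , m<n , rest)
        branch (m , m<n , inj₂ (e , rest)) =
          inj₂ (_ , s-idxF eq (λ e′ → e (trans (idx≡ a) (trans e′ (sym (idx≡ b))))) , _ , sim R , m , m<n , rest)
    step⁻¹ stopI eq done stop = inj₁ (eq , refl)
    step⁻¹ stopI eq (s ∷ₛ _) stop =
      ⊥-elim (halted-irreducible Q (stop-halted Q {Z = Z′} {I = I′} (CodeAt-< (blockAt ℓ eq)) (CodeAt-head (blockAt ℓ eq))) s)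
    step⁻¹ (choiceI _ ℓ₁ ℓ₂) eq {n} {f} ss stop = leave (ChoiceGadget.Runs.gadget-steps⁻¹ R (start ℓ) ℓ₁ ℓ₂ (gadgetAt _ _ _ (blockAt ℓ eq)) ss stop)
      where
        open ChoiceGadget R
        leave : Σ (ℕ → U) (λ Z₄ → AgreeFrom K Z₄ savedZ × Σ ℕ λ m → m < n ×
                  (Steps (Move Q) m ⟨ label (start ℓ₁) , restoredZ Z₄ , restoredI Z₄ ⟩ f
                   ⊎ Steps (Move Q) m ⟨ label (start ℓ₂) , restoredZ Z₄ , restoredI Z₄ ⟩ f)) →
                BackStep From ⟨ ℓ , Z , I ⟩ n f
        leave (Z₄ , Z₄≈ , m , m<n , inj₁ rest) = inj₂ (_ , s-ch₁ eq , _ , sim (Restored.restored Z₄ Z₄≈) , m , m<n , rest)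
        leave (Z₄ , Z₄≈ , m , m<n , inj₂ rest) = inj₂ (_ , s-ch₂ eq , _ , sim (Restored.restored Z₄ Z₄≈) , m , m<n , rest)
    step⁻¹ (nuI () j as) eq ss stop

  step-back : ∀ {c′ c n f} → c′ ∼ c → Steps (Move Q) n c′ f → Halted Q f → BackStep c′ c n f
  step-back (sim {ℓ = ℓ} R) = Backward.step⁻¹ R (Program.body M ℓ) refl

  HaltsWithOutputOf : Config A L k → Cfg → Set
  HaltsWithOutputOf c f = Σ (Config A L k) λ d → Star StepM c d × Stopped A M d × output A d ≡ output A f

  simulate-back : ∀ fuel {n c′ c f} → n ≤ fuel → c′ ∼ c → Halted Q f → BackStep c′ c n f → HaltsWithOutputOf c f
  simulate-back _ _ c′∼c _ (inj₁ (halted , refl)) = _ , ε , halted , sym (simulates-output c′∼c)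
  simulate-back zero n≤0 _ _ (inj₂ (_ , _ , _ , _ , _ , m<n , _)) = ⊥-elim (<⇒≱ m<n (≤-trans n≤0 z≤n))
  simulate-back (suc fuel) n≤fuel _ stop (inj₂ (d , s , d′ , d′∼d , m , m<n , rest)) =
    let e , run , halted , out≡ = simulate-back fuel (≤-pred (<-≤-trans m<n n≤fuel)) d′∼d stop (step-back d′∼d rest stop)
    in e , s ◅ run , halted , out≡

  record PrologueAt : Set where
    field
      testAt : code 0 ≡ pIdx jSave (⇑ Fin.zero) 5 1
      bumpAt : CodeAt 1 bumpCode 4
      loopAt : code 4 ≡ jump 0
      tailAt : CodeAt 5 (bumpFrontier (suc margin)) base

  prologueAt : PrologueAt
  prologueAt = record
    { testAt = CodeAt-head at₀
    ; bumpAt = CodeAt-head at₁ ∷ CodeAt-head at₂ ∷ CodeAt-head at₃ ∷ [] (CodeAt-≤ at₄)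
    ; loopAt = CodeAt-head at₄ ; tailAt = CodeAt-tail at₄ }
    where
      at₀ = CodeAt-prologue refl
      at₁ = CodeAt-tail at₀
      at₂ = CodeAt-tail at₁
      at₃ = CodeAt-tail at₂
      at₄ = CodeAt-tail at₃

  bumpFrontier-regs : ∀ n Z I → runZ (bumpFrontier n) Z I ≡ Z
  bumpFrontier-regs zero Z I = refl
  bumpFrontier-regs (suc n) Z I = bumpFrontier-regs n Z (bump I)

  bumpFrontier-straight : ∀ n → All Straight (bumpFrontier n)
  bumpFrontier-straight zero = []
  bumpFrontier-straight (suc n) = incS ∷ incS ∷ incS ∷ bumpFrontier-straight n

  module Prologue (m : ℕ) (v : Vec U (suc m)) where
    open PrologueAt prologueAt

    Zin : ℕ → U
    Zin = inputReg A v

    I₀ : Fin (suc k) → ℕ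
    I₀ = updI A (λ _ → 0) Fin.zero m

    I₀′ : Fin (suc k′) → ℕ
    I₀′ = updI A (λ _ → 0) Fin.zero m

    record AtHeight (t : ℕ) (I′ : Fin (suc k′) → ℕ) : Set where
      field
        save≡    : I′ jSave ≡ t
        restore≡ : I′ jRestore ≡ t
        fill≡    : I′ jFill ≡ t
        ⇑≡       : ∀ a → I′ (⇑ a) ≡ I₀ a

    height-cong : ∀ {s t I′} → s ≡ t → AtHeight s I′ → AtHeight t I′
    height-cong refl h = h

    initial-height : AtHeight 0 I₀′
    initial-height = record
      { save≡ = updI-other (λ _ → 0) Fin.zero m jSave (⇑≢fresh Fin.zero _)
      ; restore≡ = updI-other (λ _ → 0) Fin.zero m jRestore (⇑≢fresh Fin.zero _)
      ; fill≡ = updI-other (λ _ → 0) Fin.zero m jFill (⇑≢fresh Fin.zero _)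
      ; ⇑≡ = λ a → by-cases a (a ≟ᶠ Fin.zero) }
      where
        by-cases : ∀ a → Dec (a ≡ Fin.zero) → I₀′ (⇑ a) ≡ I₀ a
        by-cases a (yes refl) = trans (updI-same (λ (_ : Fin (suc k′)) → 0) Fin.zero m) (sym (updI-same (λ (_ : Fin (suc k)) → 0) Fin.zero m))
        by-cases a (no a≢0) = trans (updI-other (λ _ → 0) Fin.zero m (⇑ a) (λ e → a≢0 (sym (FinP.↑ˡ-injective 4 _ _ e))))
                                    (sym (updI-other (λ (_ : Fin (suc k)) → 0) Fin.zero m a (≢-sym a≢0)))

    bump-height : ∀ {t I′} → AtHeight t I′ → AtHeight (suc t) (bump I′)
    bump-height {I′ = I′} h = record
      { save≡ = trans (bump-jSave I′) (cong suc save≡) ; restore≡ = trans (bump-jRestore I′) (cong suc restore≡)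
      ; fill≡ = trans (bump-jFill I′) (cong suc fill≡) ; ⇑≡ = λ a → trans (bump-⇑ I′ a) (⇑≡ a) }
      where open AtHeight h

    bumpFrontier-height : ∀ n {t I′} → AtHeight t I′ → AtHeight (t + n) (runI (bumpFrontier n) Zin I′)
    bumpFrontier-height zero {t} h = height-cong (sym (+-identityʳ t)) h
    bumpFrontier-height (suc n) {t} h = height-cong (sym (+-suc t n)) (bumpFrontier-height n (bump-height h))

    test-at-height : ∀ {t I′} → AtHeight t I′ → I′ jSave ≡ I′ (⇑ Fin.zero) → t ≡ m
    test-at-height h e = trans (sym (AtHeight.save≡ h)) (trans e (trans (AtHeight.⇑≡ h Fin.zero) (updI-same (λ (_ : Fin (suc k)) → 0) Fin.zero m)))

    test-at-input : ∀ {I′} → AtHeight m I′ → I′ jSave ≡ I′ (⇑ Fin.zero)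
    test-at-input h = trans (AtHeight.save≡ h) (sym (trans (AtHeight.⇑≡ h Fin.zero) (updI-same (λ (_ : Fin (suc k)) → 0) Fin.zero m)))

    4<N : 4 < N
    4<N = CodeAt-≤ tailAt

    0<N : 0 < N
    0<N = ≤-trans (s≤s z≤n) 4<N

    raise : ∀ d {t I′} → t + d ≡ m → AtHeight t I′ →
            Σ (Fin (suc k′) → ℕ) λ I₅ → AtHeight m I₅ × Star (Move Q) ⟨ label 0 , Zin , I′ ⟩ ⟨ label 5 , Zin , I₅ ⟩
    raise zero {t} {I′} t+0≡m h =
      let h′ = height-cong (trans (sym (+-identityʳ t)) t+0≡m) h
      in I′ , h′ , idx-true-step Q Zin I′ 0<N testAt (test-at-input h′) ◅ ε
    raise (suc d) {t} {I′} t+1+d≡m h =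
      let I₅ , h₅ , run = raise d (trans (sym (+-suc t d)) t+1+d≡m) (bump-height h)
          t≢m : t ≢ m
          t≢m t≡m = <⇒≢ (m<m+n t (s≤s z≤n)) (trans t≡m (sym t+1+d≡m))
      in I₅ , h₅ , idx-false-step Q Zin I′ 0<N testAt (λ e → t≢m (test-at-height h e)) ◅
                   (run-straight Q Zin I′ bumpAt (incS ∷ incS ∷ incS ∷ []) ◅◅ (goto-step Q Zin (bump I′) 4<N loopAt ◅ run))

    raise⁻¹ : ∀ d {t I′ n f} → t + d ≡ m → AtHeight t I′ → Steps (Move Q) n ⟨ label 0 , Zin , I′ ⟩ f → Halted Q f →
              Σ (Fin (suc k′) → ℕ) λ I₅ → AtHeight m I₅ × Σ ℕ λ n′ → n′ ≤ n × Steps (Move Q) n′ ⟨ label 5 , Zin , I₅ ⟩ f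
    raise⁻¹ zero {t} {I′} {n} {f} t+0≡m h ss stop = leave (idx-steps⁻¹ Q 0<N testAt ss stop)
      where
        h′ = height-cong (trans (sym (+-identityʳ t)) t+0≡m) h
        leave : Σ ℕ (λ n₁ → n₁ < n × ((I′ jSave ≡ I′ (⇑ Fin.zero) × Steps (Move Q) n₁ ⟨ label 5 , Zin , I′ ⟩ f)
                                      ⊎ (I′ jSave ≢ I′ (⇑ Fin.zero) × Steps (Move Q) n₁ ⟨ label 1 , Zin , I′ ⟩ f))) →
                Σ (Fin (suc k′) → ℕ) λ I₅ → AtHeight m I₅ × Σ ℕ λ n′ → n′ ≤ n × Steps (Move Q) n′ ⟨ label 5 , Zin , I₅ ⟩ f
        leave (n₁ , n₁<n , inj₁ (_ , rest)) = I′ , h′ , n₁ , <⇒≤ n₁<n , rest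
        leave (_ , _ , inj₂ (≢ , _)) = ⊥-elim (≢ (test-at-input h′))
    raise⁻¹ (suc d) {t} {I′} {n} {f} t+1+d≡m h ss stop = continue (idx-steps⁻¹ Q 0<N testAt ss stop)
      where
        continue : Σ ℕ (λ n₁ → n₁ < n × ((I′ jSave ≡ I′ (⇑ Fin.zero) × Steps (Move Q) n₁ ⟨ label 5 , Zin , I′ ⟩ f)
                                         ⊎ (I′ jSave ≢ I′ (⇑ Fin.zero) × Steps (Move Q) n₁ ⟨ label 1 , Zin , I′ ⟩ f))) →
                   Σ (Fin (suc k′) → ℕ) λ I₅ → AtHeight m I₅ × Σ ℕ λ n′ → n′ ≤ n × Steps (Move Q) n′ ⟨ label 5 , Zin , I₅ ⟩ f
        continue (_ , _ , inj₁ (e , _)) = ⊥-elim (<⇒≢ (m<m+n t (s≤s z≤n)) (trans (test-at-height h e) (sym t+1+d≡m)))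
        continue (n₁ , n₁<n , inj₂ (_ , rest₁)) =
          let n₂ , n₂≤n₁ , rest₂ = run-straight⁻¹ Q Zin I′ bumpAt (incS ∷ incS ∷ incS ∷ []) rest₁ stop
              n₃ , n₃<n₂ , rest₃ = goto-steps⁻¹ Q 4<N loopAt rest₂ stop
              I₅ , h₅ , n₄ , n₄≤n₃ , rest₄ = raise⁻¹ d (trans (sym (+-suc t d)) t+1+d≡m) (bump-height h) rest₃ stop
          in I₅ , h₅ , n₄ , ≤-trans n₄≤n₃ (≤-trans (<⇒≤ n₃<n₂) (≤-trans n₂≤n₁ (<⇒≤ n₁<n))) , rest₄

    simulates-initial : ∀ {I₅} → AtHeight m I₅ → Simulates Zin (runI (bumpFrontier (suc margin)) Zin I₅) Zin I₀
    simulates-initial h = record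
      { reg≡ = λ _ → refl ; idx≡ = ⇑≡ ; frontier = m + suc margin ; far = Vec.last v
      ; save≡ = save≡ ; restore≡ = restore≡ ; fill≡ = fill≡
      ; idx< = λ a → by-cases a (Fin.zero ≟ᶠ a)
      ; K≤ = ≤-trans (m≤m+n K maxWritten) (≤-trans (n≤1+n _) (m≤n+m _ m))
      ; written< = ≤-trans (s≤s (m≤n+m maxWritten K)) (m≤n+m _ m)
      ; beyond = λ j G≤j → inputReg-beyond v j (<-≤-trans (m<m+n m (s≤s z≤n)) G≤j) }
      where
        open AtHeight (bumpFrontier-height (suc margin) h)
        by-cases : ∀ a → Dec (Fin.zero ≡ a) → I₀ a < m + suc margin
        by-cases a (yes refl) = subst (_< m + suc margin) (sym (updI-same (λ (_ : Fin (suc k)) → 0) Fin.zero m)) (m<m+n m (s≤s z≤n))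
        by-cases a (no 0≢a) = subst (_< m + suc margin) (sym (updI-other (λ (_ : Fin (suc k)) → 0) Fin.zero m a 0≢a)) (≤-trans (s≤s z≤n) (m≤n+m _ m))

    entered : ∀ {I₅} → AtHeight m I₅ → ⟨ label base , Zin , runI (bumpFrontier (suc margin)) Zin I₅ ⟩ ∼ initial A M (m , v)
    entered {I₅} h = subst (λ p → ⟨ label p , Zin , runI (bumpFrontier (suc margin)) Zin I₅ ⟩ ∼ initial A M (m , v))
                           (+-identityʳ base) (sim (simulates-initial h))

    prologue-run : Σ Cfg λ c′ → Star (Move Q) (initial A M′ (m , v)) c′ × c′ ∼ initial A M (m , v)
    prologue-run =
      let I₅ , h₅ , loop = raise m refl initial-height
          I₆ = runI (bumpFrontier (suc margin)) Zin I₅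
      in _ , subst (λ ℓ → Star (Move Q) ⟨ ℓ , Zin , I₀′ ⟩ ⟨ label base , Zin , I₆ ⟩) label-zero
               (loop ◅◅ subst (λ Z → Star (Move Q) ⟨ label 5 , Zin , I₅ ⟩ ⟨ label base , Z , I₆ ⟩) (bumpFrontier-regs (suc margin) Zin I₅)
                                (run-straight Q Zin I₅ tailAt (bumpFrontier-straight (suc margin)))) ,
           entered h₅

    prologue-run⁻¹ : ∀ {n f} → Steps (Move Q) n (initial A M′ (m , v)) f → Halted Q f →
                     Σ Cfg λ c′ → c′ ∼ initial A M (m , v) × Σ ℕ λ n′ → n′ ≤ n × Steps (Move Q) n′ c′ f
    prologue-run⁻¹ {n} {f} ss stop =
      let I₅ , h₅ , n₁ , n₁≤n , rest₁ = raise⁻¹ m refl initial-height (subst (λ ℓ → Steps (Move Q) n ⟨ ℓ , Zin , I₀′ ⟩ f) (sym label-zero) ss) stop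
          I₆ = runI (bumpFrontier (suc margin)) Zin I₅
          n₂ , n₂≤n₁ , rest₂ = run-straight⁻¹ Q Zin I₅ tailAt (bumpFrontier-straight (suc margin)) rest₁ stop
      in _ , entered h₅ , n₂ , ≤-trans n₂≤n₁ n₁≤n ,
         subst (λ Z → Steps (Move Q) n₂ ⟨ label base , Z , I₆ ⟩ f) (bumpFrontier-regs (suc margin) Zin I₅) rest₂

  M′-simulates : ∀ x y → ResNDB A M x y ⇔ Resν A Q M′ x y
  M′-simulates (m , v) y = mk⇔ forward backward
    where
      open Prologue m v
      forward : ResNDB A M (m , v) y → Resν A Q M′ (m , v) y
      forward (c , run , halted , out≡) =
        let c′ , run₀ , c′∼ = prologue-run
            d′ , run₁ , d′∼c = simulate-run c′∼ run
        in d′ , run₀ ◅◅ run₁ , simulates-halted d′∼c halted , trans (simulates-output d′∼c) out≡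
      backward : Resν A Q M′ (m , v) y → ResNDB A M (m , v) y
      backward (f , run , halted , out≡) =
        let n , steps = Star⇒Steps run
            c′ , c′∼ , n′ , _ , rest = prologue-run⁻¹ steps halted
            d , run′ , haltedM , out≡′ = simulate-back n′ ≤-refl c′∼ halted (step-back c′∼ rest halted)
        in d , run′ , haltedM , trans out≡′ out≡

theorem6p27 : (A : Structure) → (i₁ i₂ : Fin (Structure.nc A)) →
    Structure.const A i₁ ≢ Structure.const A i₂ →
    (DEC A ⟦ Structure.const A i₁ ⟧₁
      ⊎ (SDEC A ⟦ Structure.const A i₁ ⟧₁ × SDEC A ⟦ Structure.const A i₂ ⟧₁)) →
    (M : Program A ndb) →
    Σ (Program A nu) λ M′ →
      ∀ x y → (ResNDB A M x y ⇔ Resν A (Pairs A (Structure.const A i₁) (Structure.const A i₂)) M′ x y)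
theorem6p27 A i₁ i₂ c₁≢c₂ decidable M = M′ , M′-simulates
  where
    semidecider : SDEC A ⟦ Structure.const A i₁ ⟧₁
    semidecider = [ proj₁ , proj₁ ]′ decidable
    open Simulation A i₁ i₂ c₁≢c₂ (proj₁ semidecider) (proj₂ semidecider) M
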